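{- For every constant $c>0$ there exists a constant $c'>0$ such that for every $n\ge 2$ that is a power of $2$ and all binary nets $P_1,P_2\in\mathcal{P}_0$ on the $n\times n$ grid with corner volume distance $$\Delta(P_1,P_2)\ge c\,n^2\log n,$$ we have $\mathrm{disc}(P_1\uplus P_2,\mathcal{R}_2)\ge c'\log n$.
   Context: Let $n$ be a power of $2$; logarithms are base 2. The grid points are $(i+\tfrac12,j+\tfrac12)$ for $i,j\in\{0,\dots,n-1\}$, inside $[0,n)^2$. For $k\in\{0,1,\dots,\log n\}$, $i\in\{0,\dots,n/2^k-1\}$, $j\in\{0,\dots,2^k-1\}$, the $k$-canonical cell is $G_k(i,j)=[i2^k,(i+1)2^k)\times[j\,n/2^k,(j+1)\,n/2^k)$. A binary net is a set $P$ of grid points such that $|P\cap G_k(i,j)|=1$ for every $k\in\{0,\dots,\log n\}$ and all admissible $i,j$; $\mathcal{P}_0$ is the collection of binary nets. For $P\in\mathcal{P}_0$ and $q$ the unique point of $P$ in $G_k(i,j)$, the corner volume $V_P(k,i,j)=d_xd_y$, where $d_x$ is the distance from $q$ to the nearer of the two vertical sides of $G_k(i,j)$ and $d_y$ the distance from $q$ to the nearer of the two horizontal sides (the area of the rectangle spanned by $q$ and its nearest corner of the cell). The corner volume distance is $\Delta(P_1,P_2)=\sum_{k=0}^{\log n}\sum_{i=0}^{n/2^k-1}\sum_{j=0}^{2^k-1}|V_{P_1}(k,i,j)-V_{P_2}(k,i,j)|$. $P_1\uplus P_2$ is the multiset union (common points counted twice). $\mathcal{R}_2$ is the set of axis-parallel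 rectangles and for a finite multiset $X$, $\mathrm{disc}(X,\mathcal{R}_2)=\min_\chi\max_{R\in\mathcal{R}_2}|\sum_{p\in X\cap R}\chi(p)|$ over colorings $\chi$ of the elements of $X$ (with multiplicity) by $\{ -1,+1\}$.
   Formalization: The constant c in the hypothesis on the corner volume distance ranges over the positive rationals. -}

module Defs where

open import Data.Nat using (ℕ; zero; suc; _+_; _*_; _∸_; _^_; _≤_; _<_; _⊓_; _≤ᵇ_; _<ᵇ_; ∣_-_∣)
open import Data.Fin using (Fin; toℕ)
open import Data.Bool using (Bool; true; false; _∧_; if_then_else_)
open import Data.Sign using (Sign)
open import Data.Integer as ℤ using (ℤ; +_; _◃_)
open import Data.Rational as ℚ using (ℚ)
open import Data.Product using (∃)
open import Relation.Binary.PropositionalEquality using (_≡_)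

sumFin : ∀ {n} → (Fin n → ℕ) → ℕ
sumFin {zero} f = 0
sumFin {suc n} f = f Fin.zero + sumFin (λ i → f (Fin.suc i))

sumFinℤ : ∀ {n} → (Fin n → ℤ) → ℤ
sumFinℤ {zero} f = + 0
sumFinℤ {suc n} f = f Fin.zero ℤ.+ sumFinℤ (λ i → f (Fin.suc i))

sumNat : ℕ → (ℕ → ℕ) → ℕ
sumNat zero f = 0
sumNat (suc N) f = sumNat N f + f N

-- n = 2 ^ m, log n = m.  Grid point (x,y) : Fin n × Fin n stands for (x+1/2, y+1/2).
-- A set of grid points is given by its (Boolean) membership predicate.
PointSet : ℕ → Set
PointSet m = Fin (2 ^ m) → Fin (2 ^ m) → Bool

-- width 2^k and height n/2^k = 2^(m-k) of a k-canonical cell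
cellW : ℕ → ℕ
cellW k = 2 ^ k

cellH : ℕ → ℕ → ℕ
cellH m k = 2 ^ (m ∸ k)

-- does the grid point (x+1/2, y+1/2) lie in G_k(i,j) = [i 2^k,(i+1)2^k) × [j n/2^k,(j+1) n/2^k) ?
inCell : (m k i j : ℕ) → ℕ → ℕ → Bool
inCell m k i j x y =
  ((i * cellW k) ≤ᵇ x) ∧ (x <ᵇ (suc i * cellW k)) ∧
  ((j * cellH m k) ≤ᵇ y) ∧ (y <ᵇ (suc j * cellH m k))

cellCount : (m : ℕ) → PointSet m → (k i j : ℕ) → ℕ
cellCount m P k i j =
  sumFin (λ x → sumFin (λ y →
    if P x y ∧ inCell m k i j (toℕ x) (toℕ y) then 1 else 0))

IsBinaryNet : (m : ℕ) → PointSet m → Set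
IsBinaryNet m P =
  ∀ k → k ≤ m → ∀ i → i < 2 ^ (m ∸ k) → ∀ j → j < 2 ^ k → cellCount m P k i j ≡ 1

-- 4 * (corner volume of point (x+1/2,y+1/2) w.r.t. G_k(i,j)), i.e. (2 d_x)(2 d_y)
cornerVol4 : (m k i j x y : ℕ) → ℕ
cornerVol4 m k i j x y =
  ((2 * x + 1 ∸ 2 * (i * cellW k)) ⊓ (2 * (suc i * cellW k) ∸ (2 * x + 1))) *
  ((2 * y + 1 ∸ 2 * (j * cellH m k)) ⊓ (2 * (suc j * cellH m k) ∸ (2 * y + 1)))

-- 4 * V_P(k,i,j): sum over the points of P in the cell (for a binary net exactly one)
V4 : (m : ℕ) → PointSet m → (k i j : ℕ) → ℕ
V4 m P k i j =
  sumFin (λ x → sumFin (λ y →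
    if P x y ∧ inCell m k i j (toℕ x) (toℕ y) then cornerVol4 m k i j (toℕ x) (toℕ y) else 0))

-- 4 * Δ(P1,P2)
Δ4 : (m : ℕ) → PointSet m → PointSet m → ℕ
Δ4 m P₁ P₂ =
  sumNat (suc m) (λ k → sumNat (2 ^ (m ∸ k)) (λ i → sumNat (2 ^ k) (λ j →
    ∣ V4 m P₁ k i j - V4 m P₂ k i j ∣)))

cornerVolumeDistance : (m : ℕ) → PointSet m → PointSet m → ℚ
cornerVolumeDistance m P₁ P₂ = (+ Δ4 m P₁ P₂) ℚ./ 4

ℕtoℚ : ℕ → ℚ
ℕtoℚ a = (+ a) ℚ./ 1

-- closed axis-parallel rectangle [x₁,x₂] × [y₁,y₂] (rational corners suffice:
-- every real rectangle cuts out the same point set as some rational one)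
record Rectangle : Set where
  constructor rect
  field
    x₁ x₂ y₁ y₂ : ℚ

inRect : Rectangle → ℕ → ℕ → Bool
inRect (rect x₁ x₂ y₁ y₂) x y =
  (x₁ ℚ.≤ᵇ px) ∧ (px ℚ.≤ᵇ x₂) ∧ (y₁ ℚ.≤ᵇ py) ∧ (py ℚ.≤ᵇ y₂)
  where
  px = (+ (2 * x + 1)) ℚ./ 2
  py = (+ (2 * y + 1)) ℚ./ 2

Colouring : ℕ → Set
Colouring m = Fin (2 ^ m) → Fin (2 ^ m) → Sign

signedSum : (m : ℕ) → PointSet m → Colouring m → Rectangle → ℤ
signedSum m P χ R =
  sumFinℤ (λ x → sumFinℤ (λ y →
    if P x y ∧ inRect R (toℕ x) (toℕ y) then χ x y ◃ 1 else + 0))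

-- A colouring of the multiset union P₁ ⊎ P₂ colours the
-- copy of each point coming from P₁ (by χ₁) and from P₂ (by χ₂) independently,
-- so common points are counted twice.  min_χ max_R |..| ≥ t  unfolds to
-- "for every colouring there is a rectangle with |..| ≥ t" (finitely many colourings,
-- finitely many distinct traces of rectangles).
DiscUnionAtLeast : (m : ℕ) → PointSet m → PointSet m → ℚ → Set
DiscUnionAtLeast m P₁ P₂ t =
  ∀ (χ₁ χ₂ : Colouring m) → ∃ λ (R : Rectangle) →
    t ℚ.≤ ℕtoℚ ℤ.∣ signedSum m P₁ χ₁ R ℤ.+ signedSum m P₂ χ₂ R ∣

-- Give every point of P₁ ⊎ P₂ its colour as a weight w, and let D(u,v) be the coloured sum over the
-- anchored box [0,u/2] × [0,v/2].  Paired with the indicator of the quadrant above a point of a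
-- k-canonical cell, the product Haar function h of the cell gives (four times) the corner volume of the
-- point.  Hence pairing D with f_k = Σ_cells ε·h, where ε is the sign of the correlation c_k of w with
-- the corner volumes of the cell, gives Σ_cells |c_k|; and since a binary net has exactly one point
-- per cell, |c_k| ≥ |V_{P₁} − V_{P₂}|, so Σ_k Σ_cells |c_k| ≥ Δ(P₁,P₂).
-- Now test D against the Riesz product Π = ∏_{k ≤ log n} (L + f_k).  Since Π ≥ 0 has total mass
-- (2n)² L^{log n + 1}, |⟨D, Π − L^{log n + 1}⟩| ≤ 2 (2n)² L^{log n + 1} max |D|.  On the other hand the
-- product of the first k factors integrates to L^k times the length over every block of a k-canonical
-- cell, and to within L^k/(L − 1) times the block length over any final segment of it; expanding the
-- product one level at a time, ⟨D, Π − L^{log n + 1}⟩ is therefore L^{log n} Σ_k Σ_cells |c_k| up to an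
-- error of at most (log n + 1) (2n)² L^{log n}/(L − 1).  With c ≥ 1/q and L = 4q + 1 the main term wins,
-- and max |D| ≥ log n / (1 + 4q(4q + 1)).

module Submission where

module RieszProducts where

  open import Data.Nat as ℕ using (ℕ; zero; suc; _≤_; _<_; z≤n; s≤s; _^_; _∸_; ⌊_/2⌋; _≤ᵇ_; _<ᵇ_)
  import Data.Nat.Properties as ℕP
  open import Algebra.Properties.CommutativeSemigroup ℕP.*-commutativeSemigroup using (x∙yz≈y∙xz)
  open import Data.Integer as ℤ using (ℤ; +_; -_; _+_; _*_; _-_; ∣_∣; _◃_)
  import Data.Integer.Properties as ℤP
  open import Data.Bool using (Bool; true; false; if_then_else_; _∧_; T)
  import Data.Bool.Properties as BoolP
  open import Data.Unit using (tt)
  open import Data.Empty using (⊥-elim)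
  open import Function using (_∘_)
  open import Function.Bundles using (Equivalence)
  open import Data.Sum as Sum using (_⊎_; inj₁; inj₂)
  open import Data.Product using (∃; ∃₂; _,_; _×_; proj₁; proj₂)
  open import Relation.Binary.Definitions using (tri<; tri≈; tri>)
  open import Relation.Binary.PropositionalEquality
  import Data.Nat.Tactic.RingSolver as ℕ-Solver
  import Data.Integer.Tactic.RingSolver as ℤ-Solver
  open import Data.Rational as ℚ using (ℚ; 0ℚ; toℚᵘ)
  import Data.Rational.Properties as ℚP
  open import Data.Rational.Unnormalised as ℚᵘ using (mkℚᵘ) renaming (_≃_ to _≃ᵘ_; _≤_ to _≤ᵘ_)
  import Data.Rational.Unnormalised.Properties as ℚᵘP
  open import Data.Fin as Fin using (Fin; toℕ)
  open import Data.Sign as Sign using (Sign)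
  open import Defs

  -- Finite sums

  Σℤ : ℕ → (ℕ → ℤ) → ℤ
  Σℤ zero g = + 0
  Σℤ (suc n) g = g 0 + Σℤ n (λ t → g (suc t))

  Σℕ : ℕ → (ℕ → ℕ) → ℕ
  Σℕ zero g = 0
  Σℕ (suc n) g = g 0 ℕ.+ Σℕ n (λ t → g (suc t))

  Σℤ-cong : ∀ n {g h : ℕ → ℤ} → (∀ t → t < n → g t ≡ h t) → Σℤ n g ≡ Σℤ n h
  Σℤ-cong zero e = refl
  Σℤ-cong (suc n) e = cong₂ _+_ (e 0 (s≤s z≤n)) (Σℤ-cong n (λ t lt → e (suc t) (s≤s lt)))

  Σℕ-cong : ∀ n {g h : ℕ → ℕ} → (∀ t → t < n → g t ≡ h t) → Σℕ n g ≡ Σℕ n h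
  Σℕ-cong zero e = refl
  Σℕ-cong (suc n) e = cong₂ ℕ._+_ (e 0 (s≤s z≤n)) (Σℕ-cong n (λ t lt → e (suc t) (s≤s lt)))

  Σℤ-vanish : ∀ n (g : ℕ → ℤ) → (∀ t → t < n → g t ≡ + 0) → Σℤ n g ≡ + 0
  Σℤ-vanish zero g e = refl
  Σℤ-vanish (suc n) g e = cong₂ _+_ (e 0 (s≤s z≤n)) (Σℤ-vanish n _ (λ t lt → e (suc t) (s≤s lt)))

  Σℤ-+ : ∀ n (g h : ℕ → ℤ) → Σℤ n (λ t → g t + h t) ≡ Σℤ n g + Σℤ n h
  Σℤ-+ zero g h = refl
  Σℤ-+ (suc n) g h rewrite Σℤ-+ n (λ t → g (suc t)) (λ t → h (suc t)) =
    interchange (g 0) (h 0) (Σℤ n (λ t → g (suc t))) (Σℤ n (λ t → h (suc t)))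
    where
    interchange : ∀ a b c d → a + b + (c + d) ≡ a + c + (b + d)
    interchange = ℤ-Solver.solve-∀

  Σℤ-*ˡ : ∀ n c (g : ℕ → ℤ) → Σℤ n (λ t → c * g t) ≡ c * Σℤ n g
  Σℤ-*ˡ zero c g = sym (ℤP.*-zeroʳ c)
  Σℤ-*ˡ (suc n) c g rewrite Σℤ-*ˡ n c (λ t → g (suc t)) = sym (ℤP.*-distribˡ-+ c (g 0) _)

  Σℤ-*ʳ : ∀ n c (g : ℕ → ℤ) → Σℤ n (λ t → g t * c) ≡ Σℤ n g * c
  Σℤ-*ʳ n c g = trans (Σℤ-cong n (λ t _ → ℤP.*-comm (g t) c)) (trans (Σℤ-*ˡ n c g) (ℤP.*-comm c _))

  Σℤ-neg : ∀ n (g : ℕ → ℤ) → Σℤ n (λ t → - g t) ≡ - Σℤ n g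
  Σℤ-neg n g = trans (Σℤ-cong n (λ t _ → sym (ℤP.-1*i≡-i (g t)))) (trans (Σℤ-*ˡ n (- + 1) g) (ℤP.-1*i≡-i _))

  Σℤ-sub : ∀ n (g h : ℕ → ℤ) → Σℤ n (λ t → g t - h t) ≡ Σℤ n g - Σℤ n h
  Σℤ-sub n g h = trans (Σℤ-+ n g (λ t → - h t)) (cong (_+_ (Σℤ n g)) (Σℤ-neg n h))

  Σℤ-split : ∀ a b (g : ℕ → ℤ) → Σℤ (a ℕ.+ b) g ≡ Σℤ a g + Σℤ b (λ t → g (a ℕ.+ t))
  Σℤ-split zero b g = sym (ℤP.+-identityˡ _)
  Σℤ-split (suc a) b g rewrite Σℤ-split a b (λ t → g (suc t)) = sym (ℤP.+-assoc (g 0) _ _)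

  Σℤ-swap : ∀ n k (g : ℕ → ℕ → ℤ) → Σℤ n (λ i → Σℤ k (g i)) ≡ Σℤ k (λ j → Σℤ n (λ i → g i j))
  Σℤ-swap zero k g = sym (Σℤ-vanish k _ (λ _ _ → refl))
  Σℤ-swap (suc n) k g = begin
      Σℤ k (g 0) + Σℤ n (λ i → Σℤ k (g (suc i)))
    ≡⟨ cong (_+_ (Σℤ k (g 0))) (Σℤ-swap n k (λ i → g (suc i))) ⟩
      Σℤ k (g 0) + Σℤ k (λ j → Σℤ n (λ i → g (suc i) j))
    ≡⟨ sym (Σℤ-+ k (g 0) _) ⟩
      Σℤ k (λ j → Σℤ (suc n) (λ i → g i j)) ∎
    where open ≡-Reasoning

  Σℤ-blocks : ∀ B M (g : ℕ → ℤ) → Σℤ (B ℕ.* M) g ≡ Σℤ B (λ β → Σℤ M (λ t → g (β ℕ.* M ℕ.+ t)))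
  Σℤ-blocks zero M g = refl
  Σℤ-blocks (suc B) M g = begin
      Σℤ (M ℕ.+ B ℕ.* M) g
    ≡⟨ Σℤ-split M (B ℕ.* M) g ⟩
      Σℤ M g + Σℤ (B ℕ.* M) (λ t → g (M ℕ.+ t))
    ≡⟨ cong (_+_ (Σℤ M g)) (Σℤ-blocks B M (λ t → g (M ℕ.+ t))) ⟩
      Σℤ M g + Σℤ B (λ β → Σℤ M (λ t → g (M ℕ.+ (β ℕ.* M ℕ.+ t))))
    ≡⟨ cong (_+_ (Σℤ M g)) (Σℤ-cong B (λ β _ → Σℤ-cong M (λ t _ → cong g (sym (ℕP.+-assoc M (β ℕ.* M) t))))) ⟩
      Σℤ M g + Σℤ B (λ β → Σℤ M (λ t → g (suc β ℕ.* M ℕ.+ t))) ∎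
    where open ≡-Reasoning

  Σℤ-single : ∀ n (g : ℕ → ℤ) β → β < n → (∀ t → t < n → t ≢ β → g t ≡ + 0) → Σℤ n g ≡ g β
  Σℤ-single (suc n) g zero _ e =
    trans (cong (_+_ (g 0)) (Σℤ-vanish n _ (λ t lt → e (suc t) (s≤s lt) (λ ())))) (ℤP.+-identityʳ _)
  Σℤ-single (suc n) g (suc β) (s≤s lt) e =
    trans (cong (_+ Σℤ n (λ t → g (suc t))) (e 0 (s≤s z≤n) (λ ())))
      (trans (ℤP.+-identityˡ _)
        (Σℤ-single n (λ t → g (suc t)) β lt (λ t lt' ne → e (suc t) (s≤s lt') (ne ∘ ℕP.suc-injective))))

  ∣Σℤ∣≤Σℕ∣∣ : ∀ n (g : ℕ → ℤ) → ∣ Σℤ n g ∣ ≤ Σℕ n (λ t → ∣ g t ∣)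
  ∣Σℤ∣≤Σℕ∣∣ zero g = z≤n
  ∣Σℤ∣≤Σℕ∣∣ (suc n) g =
    ℕP.≤-trans (ℤP.∣i+j∣≤∣i∣+∣j∣ (g 0) _) (ℕP.+-monoʳ-≤ ∣ g 0 ∣ (∣Σℤ∣≤Σℕ∣∣ n (λ t → g (suc t))))

  Σℤ-pos : ∀ n (g : ℕ → ℕ) → Σℤ n (λ t → + g t) ≡ + Σℕ n g
  Σℤ-pos zero g = refl
  Σℤ-pos (suc n) g rewrite Σℤ-pos n (λ t → g (suc t)) = refl

  Σℕ-mono : ∀ n (g h : ℕ → ℕ) → (∀ t → t < n → g t ≤ h t) → Σℕ n g ≤ Σℕ n h
  Σℕ-mono zero g h le = z≤n
  Σℕ-mono (suc n) g h le = ℕP.+-mono-≤ (le 0 (s≤s z≤n)) (Σℕ-mono n _ _ (λ t lt → le (suc t) (s≤s lt)))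

  Σℕ-+ : ∀ n (g h : ℕ → ℕ) → Σℕ n (λ t → g t ℕ.+ h t) ≡ Σℕ n g ℕ.+ Σℕ n h
  Σℕ-+ n g h = ℤP.+-injective (begin
      + Σℕ n (λ t → g t ℕ.+ h t)          ≡⟨ sym (Σℤ-pos n _) ⟩
      Σℤ n (λ t → + (g t ℕ.+ h t))         ≡⟨ Σℤ-cong n (λ t _ → ℤP.pos-+ (g t) (h t)) ⟩
      Σℤ n (λ t → + g t + + h t)           ≡⟨ Σℤ-+ n _ _ ⟩
      Σℤ n (λ t → + g t) + Σℤ n (λ t → + h t) ≡⟨ cong₂ _+_ (Σℤ-pos n g) (Σℤ-pos n h) ⟩
      + Σℕ n g + + Σℕ n h                  ≡⟨ sym (ℤP.pos-+ (Σℕ n g) (Σℕ n h)) ⟩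
      + (Σℕ n g ℕ.+ Σℕ n h) ∎)
    where open ≡-Reasoning

  Σℕ-*ˡ : ∀ n c (g : ℕ → ℕ) → Σℕ n (λ t → c ℕ.* g t) ≡ c ℕ.* Σℕ n g
  Σℕ-*ˡ zero c g = sym (ℕP.*-zeroʳ c)
  Σℕ-*ˡ (suc n) c g rewrite Σℕ-*ˡ n c (λ t → g (suc t)) = sym (ℕP.*-distribˡ-+ c (g 0) _)

  Σℕ-*ʳ : ∀ n c (g : ℕ → ℕ) → Σℕ n (λ t → g t ℕ.* c) ≡ Σℕ n g ℕ.* c
  Σℕ-*ʳ n c g = trans (Σℕ-cong n (λ t _ → ℕP.*-comm (g t) c)) (trans (Σℕ-*ˡ n c g) (ℕP.*-comm c _))

  Σℕ-const : ∀ n c → Σℕ n (λ _ → c) ≡ n ℕ.* c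
  Σℕ-const zero c = refl
  Σℕ-const (suc n) c = cong (c ℕ.+_) (Σℕ-const n c)

  Σℕ-snoc : ∀ n (f : ℕ → ℕ) → Σℕ (suc n) f ≡ Σℕ n f ℕ.+ f n
  Σℕ-snoc zero f = ℕP.+-comm (f 0) 0
  Σℕ-snoc (suc n) f = trans (cong (f 0 ℕ.+_) (Σℕ-snoc n (λ t → f (suc t)))) (sym (ℕP.+-assoc (f 0) _ _))

  sumNat-mono-Σℕ : ∀ n (f g : ℕ → ℕ) → (∀ t → t < n → f t ≤ g t) → sumNat n f ≤ Σℕ n g
  sumNat-mono-Σℕ zero f g le = z≤n
  sumNat-mono-Σℕ (suc n) f g le =
    ℕP.≤-trans (ℕP.+-mono-≤ (sumNat-mono-Σℕ n f g (λ t lt → le t (ℕP.m≤n⇒m≤1+n lt))) (le n ℕP.≤-refl))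
               (ℕP.≤-reflexive (sym (Σℕ-snoc n g)))

  sumNat-mono : ∀ n (f g : ℕ → ℕ) → (∀ t → t < n → f t ≤ g t) → sumNat n f ≤ sumNat n g
  sumNat-mono zero f g le = z≤n
  sumNat-mono (suc n) f g le = ℕP.+-mono-≤ (sumNat-mono n f g (λ t lt → le t (ℕP.m≤n⇒m≤1+n lt))) (le n ℕP.≤-refl)

  Σℤ²-weighted-bound : ∀ a b (g e : ℕ → ℕ → ℤ) k Q → (∀ x y → k ℕ.* ∣ e x y ∣ ≤ Q) →
    k ℕ.* ∣ Σℤ a (λ x → Σℤ b (λ y → g x y * e x y)) ∣ ≤ Σℕ a (λ x → Σℕ b (λ y → ∣ g x y ∣)) ℕ.* Q
  Σℤ²-weighted-bound a b g e k Q bound = begin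
      k ℕ.* ∣ Σℤ a (λ x → Σℤ b (λ y → g x y * e x y)) ∣
        ≤⟨ ℕP.*-monoʳ-≤ k (ℕP.≤-trans (∣Σℤ∣≤Σℕ∣∣ a _) (Σℕ-mono a _ _ (λ x _ → ∣Σℤ∣≤Σℕ∣∣ b _))) ⟩
      k ℕ.* Σℕ a (λ x → Σℕ b (λ y → ∣ g x y * e x y ∣))
        ≡⟨ sym (trans (Σℕ-cong a (λ x _ → Σℕ-*ˡ b k _)) (Σℕ-*ˡ a k _)) ⟩
      Σℕ a (λ x → Σℕ b (λ y → k ℕ.* ∣ g x y * e x y ∣))
        ≤⟨ Σℕ-mono a _ _ (λ x _ → Σℕ-mono b _ _ (λ y _ → pointwise x y)) ⟩
      Σℕ a (λ x → Σℕ b (λ y → ∣ g x y ∣ ℕ.* Q))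
        ≡⟨ trans (Σℕ-cong a (λ x _ → Σℕ-*ʳ b Q _)) (Σℕ-*ʳ a Q _) ⟩
      Σℕ a (λ x → Σℕ b (λ y → ∣ g x y ∣)) ℕ.* Q ∎
    where
    open ℕP.≤-Reasoning
    pointwise : ∀ x y → k ℕ.* ∣ g x y * e x y ∣ ≤ ∣ g x y ∣ ℕ.* Q
    pointwise x y = begin
      k ℕ.* ∣ g x y * e x y ∣         ≡⟨ cong (k ℕ.*_) (ℤP.abs-* (g x y) (e x y)) ⟩
      k ℕ.* (∣ g x y ∣ ℕ.* ∣ e x y ∣) ≡⟨ x∙yz≈y∙xz k ∣ g x y ∣ ∣ e x y ∣ ⟩
      ∣ g x y ∣ ℕ.* (k ℕ.* ∣ e x y ∣) ≤⟨ ℕP.*-monoʳ-≤ ∣ g x y ∣ (bound x y) ⟩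
      ∣ g x y ∣ ℕ.* Q ∎

  Σℤ²-swap : ∀ a b c d (g : ℕ → ℕ → ℕ → ℕ → ℤ) →
    Σℤ a (λ x → Σℤ b (λ y → Σℤ c (λ u → Σℤ d (λ v → g x y u v)))) ≡
    Σℤ c (λ u → Σℤ d (λ v → Σℤ a (λ x → Σℤ b (λ y → g x y u v))))
  Σℤ²-swap a b c d g = begin
      Σℤ a (λ x → Σℤ b (λ y → Σℤ c (λ u → Σℤ d (λ v → g x y u v))))
        ≡⟨ Σℤ-cong a (λ x _ → Σℤ-swap b c (λ y u → Σℤ d (λ v → g x y u v))) ⟩
      Σℤ a (λ x → Σℤ c (λ u → Σℤ b (λ y → Σℤ d (λ v → g x y u v))))
        ≡⟨ Σℤ-swap a c _ ⟩
      Σℤ c (λ u → Σℤ a (λ x → Σℤ b (λ y → Σℤ d (λ v → g x y u v))))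
        ≡⟨ Σℤ-cong c (λ u _ → Σℤ-cong a (λ x _ → Σℤ-swap b d (λ y v → g x y u v))) ⟩
      Σℤ c (λ u → Σℤ a (λ x → Σℤ d (λ v → Σℤ b (λ y → g x y u v))))
        ≡⟨ Σℤ-cong c (λ u _ → Σℤ-swap a d _) ⟩
      Σℤ c (λ u → Σℤ d (λ v → Σℤ a (λ x → Σℤ b (λ y → g x y u v)))) ∎
    where open ≡-Reasoning

  -- Dyadic blocks, signs and step functions

  half^ : ℕ → ℕ → ℕ
  half^ zero u = u
  half^ (suc k) u = ⌊ half^ k u /2⌋

  even : ℕ → Bool
  even zero = true
  even (suc zero) = false
  even (suc (suc n)) = even n

  −1^_ : ℕ → ℤ
  −1^ q = if even q then + 1 else - + 1

  𝟙[_≤_] : ℕ → ℕ → ℤ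
  𝟙[ zero ≤ t ] = + 1
  𝟙[ suc w ≤ zero ] = + 0
  𝟙[ suc w ≤ suc t ] = 𝟙[ w ≤ t ]

  2^suc : ∀ k → 2 ^ suc k ≡ 2 ^ k ℕ.+ 2 ^ k
  2^suc k = cong (2 ^ k ℕ.+_) (ℕP.+-identityʳ (2 ^ k))

  *-2*-swap : ∀ b p → b ℕ.* (2 ℕ.* p) ≡ (2 ℕ.* b) ℕ.* p
  *-2*-swap = ℕ-Solver.solve-∀

  block-lower : ∀ b p t → b ℕ.* (2 ℕ.* p) ℕ.+ t ≡ (2 ℕ.* b) ℕ.* p ℕ.+ t
  block-lower b p t = cong (ℕ._+ t) (*-2*-swap b p)

  block-upper : ∀ b p t → b ℕ.* (2 ℕ.* p) ℕ.+ (p ℕ.+ t) ≡ (2 ℕ.* b ℕ.+ 1) ℕ.* p ℕ.+ t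
  block-upper = ℕ-Solver.solve-∀

  half-2*+ : ∀ b w → ⌊ 2 ℕ.* b ℕ.+ w /2⌋ ≡ b ℕ.+ ⌊ w /2⌋
  half-2*+ zero w = refl
  half-2*+ (suc b) w rewrite ℕP.+-suc b (b ℕ.+ 0) = cong suc (half-2*+ b w)

  half^-*2^+ : ∀ k b w → half^ k (b ℕ.* 2 ^ k ℕ.+ w) ≡ b ℕ.+ half^ k w
  half^-*2^+ zero b w rewrite ℕP.*-identityʳ b = refl
  half^-*2^+ (suc k) b w = begin
      ⌊ half^ k (b ℕ.* (2 ℕ.* 2 ^ k) ℕ.+ w) /2⌋ ≡⟨ cong (λ z → ⌊ half^ k (z ℕ.+ w) /2⌋) (*-2*-swap b (2 ^ k)) ⟩
      ⌊ half^ k ((2 ℕ.* b) ℕ.* 2 ^ k ℕ.+ w) /2⌋ ≡⟨ cong ⌊_/2⌋ (half^-*2^+ k (2 ℕ.* b) w) ⟩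
      ⌊ 2 ℕ.* b ℕ.+ half^ k w /2⌋              ≡⟨ half-2*+ b (half^ k w) ⟩
      b ℕ.+ ⌊ half^ k w /2⌋ ∎
    where open ≡-Reasoning

  half< : ∀ a c → a < 2 ℕ.* c → ⌊ a /2⌋ < c
  half< zero (suc c) lt = s≤s z≤n
  half< (suc zero) (suc c) lt = s≤s z≤n
  half< (suc (suc a)) (suc c) (s≤s lt) rewrite ℕP.+-suc c (c ℕ.+ 0) = s≤s (half< a c (ℕP.≤-pred lt))

  half^-< : ∀ k w c → w < c ℕ.* 2 ^ k → half^ k w < c
  half^-< zero w c lt rewrite ℕP.*-identityʳ c = lt
  half^-< (suc k) w c lt =
    half< (half^ k w) c (half^-< k w (2 ℕ.* c) (subst (w <_) (*-2*-swap c (2 ^ k)) lt))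

  half^-small : ∀ k w → w < 2 ^ k → half^ k w ≡ 0
  half^-small k w lt = ℕP.n<1⇒n≡0 (half^-< k w 1 (subst (w <_) (sym (ℕP.*-identityˡ (2 ^ k))) lt))

  half^-+ : ∀ a b v → half^ (a ℕ.+ b) v ≡ half^ a (half^ b v)
  half^-+ zero b v = refl
  half^-+ (suc a) b v = cong ⌊_/2⌋ (half^-+ a b v)

  half^-block : ∀ k b w → w < 2 ^ k → half^ k (b ℕ.* 2 ^ k ℕ.+ w) ≡ b
  half^-block k b w lt = trans (half^-*2^+ k b w) (trans (cong (b ℕ.+_) (half^-small k w lt)) (ℕP.+-identityʳ b))

  half^-*2^ : ∀ k b → half^ k (b ℕ.* 2 ^ k) ≡ b
  half^-*2^ k b = trans (cong (half^ k) (sym (ℕP.+-identityʳ (b ℕ.* 2 ^ k)))) (half^-block k b 0 (ℕP.m^n>0 2 k))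

  half^-odd : ∀ k x → half^ (suc k) (2 ℕ.* x ℕ.+ 1) ≡ half^ k x
  half^-odd k x =
    trans (cong (λ z → half^ z (2 ℕ.* x ℕ.+ 1)) (ℕP.+-comm 1 k))
      (trans (half^-+ k 1 (2 ℕ.* x ℕ.+ 1)) (cong (half^ k) (trans (half-2*+ x 1) (ℕP.+-identityʳ x))))

  half-divMod : ∀ q → ∃ λ b → b < 2 × q ≡ 2 ℕ.* ⌊ q /2⌋ ℕ.+ b
  half-divMod zero = 0 , s≤s z≤n , refl
  half-divMod (suc zero) = 1 , s≤s (s≤s z≤n) , refl
  half-divMod (suc (suc q)) with half-divMod q
  ... | b , lt , eq = b , lt , trans (cong (2 ℕ.+_) eq) (sym (expand ⌊ q /2⌋ b))
    where
    expand : ∀ h b → 2 ℕ.* (1 ℕ.+ h) ℕ.+ b ≡ 2 ℕ.+ (2 ℕ.* h ℕ.+ b)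
    expand = ℕ-Solver.solve-∀

  half^-divMod : ∀ k x → ∃ λ r → r < 2 ^ k × x ≡ half^ k x ℕ.* 2 ^ k ℕ.+ r
  half^-divMod zero x = 0 , s≤s z≤n , sym (trans (ℕP.+-identityʳ _) (ℕP.*-identityʳ x))
  half^-divMod (suc k) x with half^-divMod k x | half-divMod (half^ k x)
  ... | r , r< , eq | b , b<2 , beq =
    b ℕ.* 2 ^ k ℕ.+ r , bound ,
    trans eq (trans (cong (λ z → z ℕ.* 2 ^ k ℕ.+ r) beq) (expand ⌊ half^ k x /2⌋ b (2 ^ k) r))
    where
    expand : ∀ h b p r → (2 ℕ.* h ℕ.+ b) ℕ.* p ℕ.+ r ≡ h ℕ.* (2 ℕ.* p) ℕ.+ (b ℕ.* p ℕ.+ r)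
    expand = ℕ-Solver.solve-∀
    bound : b ℕ.* 2 ^ k ℕ.+ r < 2 ℕ.* 2 ^ k
    bound = ℕP.<-≤-trans (ℕP.+-monoʳ-< (b ℕ.* 2 ^ k) r<)
              (ℕP.≤-trans (ℕP.≤-reflexive (ℕP.+-comm (b ℕ.* 2 ^ k) (2 ^ k))) (ℕP.*-monoˡ-≤ (2 ^ k) b<2))

  even-2*+ : ∀ b r → even (2 ℕ.* b ℕ.+ r) ≡ even r
  even-2*+ zero r = refl
  even-2*+ (suc b) r rewrite ℕP.+-suc b (b ℕ.+ 0) = even-2*+ b r

  −1^-2*+ : ∀ b r → −1^ (2 ℕ.* b ℕ.+ r) ≡ −1^ r
  −1^-2*+ b r = cong (λ e → if e then + 1 else - + 1) (even-2*+ b r)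

  −1^-lower : ∀ k b t → t < 2 ^ k → −1^ (half^ k (b ℕ.* 2 ^ suc k ℕ.+ t)) ≡ + 1
  −1^-lower k b t lt = begin
      −1^ (half^ k (b ℕ.* (2 ℕ.* 2 ^ k) ℕ.+ t)) ≡⟨ cong (λ z → −1^ (half^ k z)) (block-lower b (2 ^ k) t) ⟩
      −1^ (half^ k ((2 ℕ.* b) ℕ.* 2 ^ k ℕ.+ t)) ≡⟨ cong −1^_ (half^-block k (2 ℕ.* b) t lt) ⟩
      −1^ (2 ℕ.* b)                             ≡⟨ cong −1^_ (sym (ℕP.+-identityʳ (2 ℕ.* b))) ⟩
      −1^ (2 ℕ.* b ℕ.+ 0)                       ≡⟨ −1^-2*+ b 0 ⟩
      + 1 ∎
    where open ≡-Reasoning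

  −1^-upper : ∀ k b t → t < 2 ^ k → −1^ (half^ k (b ℕ.* 2 ^ suc k ℕ.+ (2 ^ k ℕ.+ t))) ≡ - + 1
  −1^-upper k b t lt = begin
      −1^ (half^ k (b ℕ.* (2 ℕ.* 2 ^ k) ℕ.+ (2 ^ k ℕ.+ t))) ≡⟨ cong (λ z → −1^ (half^ k z)) (block-upper b (2 ^ k) t) ⟩
      −1^ (half^ k ((2 ℕ.* b ℕ.+ 1) ℕ.* 2 ^ k ℕ.+ t))      ≡⟨ cong −1^_ (half^-block k (2 ℕ.* b ℕ.+ 1) t lt) ⟩
      −1^ (2 ℕ.* b ℕ.+ 1)                                  ≡⟨ −1^-2*+ b 1 ⟩
      - + 1 ∎
    where open ≡-Reasoning

  −1^-periodic : ∀ a β t → −1^ (half^ a (β ℕ.* 2 ^ suc a ℕ.+ t)) ≡ −1^ (half^ a t)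
  −1^-periodic a β t = begin
      −1^ (half^ a (β ℕ.* (2 ℕ.* 2 ^ a) ℕ.+ t)) ≡⟨ cong (λ z → −1^ (half^ a z)) (block-lower β (2 ^ a) t) ⟩
      −1^ (half^ a ((2 ℕ.* β) ℕ.* 2 ^ a ℕ.+ t)) ≡⟨ cong −1^_ (half^-*2^+ a (2 ℕ.* β) t) ⟩
      −1^ (2 ℕ.* β ℕ.+ half^ a t)               ≡⟨ −1^-2*+ β (half^ a t) ⟩
      −1^ (half^ a t) ∎
    where open ≡-Reasoning

  𝟙-shift : ∀ a w t → 𝟙[ w ≤ a ℕ.+ t ] ≡ 𝟙[ w ∸ a ≤ t ]
  𝟙-shift zero w t = refl
  𝟙-shift (suc a) zero t = refl
  𝟙-shift (suc a) (suc w) t = 𝟙-shift a w t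

  𝟙-< : ∀ w t → t < w → 𝟙[ w ≤ t ] ≡ + 0
  𝟙-< (suc w) zero lt = refl
  𝟙-< (suc w) (suc t) (s≤s lt) = 𝟙-< w t lt

  𝟙-≤ᵇ : ∀ w t → 𝟙[ w ≤ t ] ≡ (if w ≤ᵇ t then + 1 else + 0)
  𝟙-≤ᵇ zero t = refl
  𝟙-≤ᵇ (suc w) zero = refl
  𝟙-≤ᵇ (suc zero) (suc t) = refl
  𝟙-≤ᵇ (suc (suc w)) (suc t) = 𝟙-≤ᵇ (suc w) t

  Σ𝟙 : ∀ h w → Σℤ h (λ t → 𝟙[ w ≤ t ]) ≡ + (h ∸ w)
  Σ𝟙 zero w = cong +_ (sym (ℕP.0∸n≡0 w))
  Σ𝟙 (suc h) zero = cong (_+_ (+ 1)) (Σ𝟙 h zero)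
  Σ𝟙 (suc h) (suc w) = trans (ℤP.+-identityˡ _) (Σ𝟙 h w)

  tent : ℕ → ℕ → ℕ
  tent M w = w ℕ.⊓ (M ∸ w)

  tent-≤ : ∀ a w → tent (2 ^ suc a) w ≤ 2 ^ a
  tent-≤ a w with ℕP.≤-total w (2 ^ a)
  ... | inj₁ w≤ = ℕP.≤-trans (ℕP.m⊓n≤m w _) w≤
  ... | inj₂ ≥w = ℕP.≤-trans (ℕP.m⊓n≤n w _)
                    (ℕP.≤-trans (ℕP.∸-monoʳ-≤ (2 ^ suc a) ≥w)
                      (ℕP.≤-reflexive (trans (cong (_∸ 2 ^ a) (2^suc a)) (ℕP.m+n∸n≡m (2 ^ a) (2 ^ a)))))

  tent-outside : ∀ M w → (w ≡ 0) ⊎ (M ≤ w) → tent M w ≡ 0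
  tent-outside M w (inj₁ refl) = refl
  tent-outside M w (inj₂ le) rewrite ℕP.m≤n⇒m∸n≡0 le = ℕP.⊓-zeroʳ w

  ∸-halves : ∀ p w → (p ∸ w) ℕ.+ (p ∸ (w ∸ p)) ≡ (p ℕ.+ p) ∸ w
  ∸-halves p w with ℕP.≤-total w p
  ... | inj₁ w≤p rewrite ℕP.m≤n⇒m∸n≡0 w≤p | ℕP.+-∸-assoc p w≤p = ℕP.+-comm (p ∸ w) p
  ... | inj₂ p≤w = begin
      (p ∸ w) ℕ.+ (p ∸ (w ∸ p))    ≡⟨ cong (ℕ._+ (p ∸ (w ∸ p))) (ℕP.m≤n⇒m∸n≡0 p≤w) ⟩
      p ∸ (w ∸ p)                  ≡⟨ cong (_∸ (w ∸ p)) (sym (ℕP.m+n∸n≡m p p)) ⟩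
      ((p ℕ.+ p) ∸ p) ∸ (w ∸ p)    ≡⟨ ℕP.∸-+-assoc (p ℕ.+ p) p (w ∸ p) ⟩
      (p ℕ.+ p) ∸ (p ℕ.+ (w ∸ p))  ≡⟨ cong ((p ℕ.+ p) ∸_) (ℕP.m+[n∸m]≡n p≤w) ⟩
      (p ℕ.+ p) ∸ w ∎
    where open ≡-Reasoning

  ∸-tent : ∀ p w → (p ∸ w) ℕ.+ tent (p ℕ.+ p) w ≡ p ∸ (w ∸ p)
  ∸-tent p w with ℕP.≤-total w p
  ... | inj₁ w≤p
    rewrite ℕP.m≤n⇒m∸n≡0 w≤p
          | ℕP.m≤n⇒m⊓n≡m (ℕP.≤-trans w≤p (subst (p ≤_) (sym (ℕP.+-∸-assoc p w≤p)) (ℕP.m≤m+n p (p ∸ w))))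
          = ℕP.m∸n+n≡m w≤p
  ... | inj₂ p≤w
    rewrite ℕP.m≤n⇒m∸n≡0 p≤w
          | ℕP.m≥n⇒m⊓n≡n (ℕP.≤-trans (ℕP.∸-monoʳ-≤ (p ℕ.+ p) p≤w) (ℕP.≤-trans (ℕP.≤-reflexive (ℕP.m+n∸n≡m p p)) p≤w))
          = trans (sym (∸-halves p w)) (cong (ℕ._+ (p ∸ (w ∸ p))) (ℕP.m≤n⇒m∸n≡0 p≤w))

  -- Integrating a step function against a Haar function gives minus the distance of the step to
  -- the nearer end of the interval.
  Σ𝟙-haar : ∀ a w → Σℤ (2 ^ suc a) (λ t → 𝟙[ w ≤ t ] * −1^ (half^ a t)) ≡ - + tent (2 ^ suc a) w
  Σ𝟙-haar a w = begin
      Σℤ (2 ^ suc a) F                                        ≡⟨ cong (λ n → Σℤ n F) (2^suc a) ⟩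
      Σℤ (p ℕ.+ p) F                                          ≡⟨ Σℤ-split p p F ⟩
      Σℤ p F + Σℤ p (λ t → F (p ℕ.+ t))                       ≡⟨ cong₂ _+_ (Σℤ-cong p lower) (Σℤ-cong p upper) ⟩
      Σℤ p (λ t → 𝟙[ w ≤ t ]) + Σℤ p (λ t → - 𝟙[ w ∸ p ≤ t ]) ≡⟨ cong₂ _+_ (Σ𝟙 p w) (trans (Σℤ-neg p _) (cong -_ (Σ𝟙 p (w ∸ p)))) ⟩
      + (p ∸ w) - + (p ∸ (w ∸ p))                             ≡⟨ cong (λ z → + (p ∸ w) - z) (trans (cong +_ (sym (∸-tent p w))) (ℤP.pos-+ (p ∸ w) _)) ⟩
      + (p ∸ w) - (+ (p ∸ w) + + tent (p ℕ.+ p) w)            ≡⟨ cancel (+ (p ∸ w)) (+ tent (p ℕ.+ p) w) ⟩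
      - + tent (p ℕ.+ p) w                                    ≡⟨ cong (λ M → - + tent M w) (sym (2^suc a)) ⟩
      - + tent (2 ^ suc a) w ∎
    where
    open ≡-Reasoning
    p = 2 ^ a
    F = λ t → 𝟙[ w ≤ t ] * −1^ (half^ a t)
    lower : ∀ t → t < p → F t ≡ 𝟙[ w ≤ t ]
    lower t lt = trans (cong (𝟙[ w ≤ t ] *_) (−1^-lower a 0 t lt)) (ℤP.*-identityʳ _)
    upper : ∀ t → t < p → F (p ℕ.+ t) ≡ - 𝟙[ w ∸ p ≤ t ]
    upper t lt = trans (cong₂ _*_ (𝟙-shift p w t) (−1^-upper a 0 t lt)) (trans (ℤP.*-comm _ (- + 1)) (ℤP.-1*i≡-i _))
    cancel : ∀ x y → x - (x + y) ≡ - y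
    cancel = ℤ-Solver.solve-∀

  IsSign : ℤ → Set
  IsSign σ = (σ ≡ + 1) ⊎ (σ ≡ - + 1)

  −1^-isSign : ∀ q → IsSign (−1^ q)
  −1^-isSign q with even q
  ... | true = inj₁ refl
  ... | false = inj₂ refl

  IsSign-* : ∀ {a b} → IsSign a → IsSign b → IsSign (a * b)
  IsSign-* (inj₁ refl) (inj₁ refl) = inj₁ refl
  IsSign-* (inj₁ refl) (inj₂ refl) = inj₂ refl
  IsSign-* (inj₂ refl) (inj₁ refl) = inj₂ refl
  IsSign-* (inj₂ refl) (inj₂ refl) = inj₁ refl

  IsSign⇒∣∣≡1 : ∀ {σ} → IsSign σ → ∣ σ ∣ ≡ 1
  IsSign⇒∣∣≡1 (inj₁ refl) = refl
  IsSign⇒∣∣≡1 (inj₂ refl) = refl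

  IsSign⇒∣*∣ : ∀ {σ} → IsSign σ → ∀ z → ∣ σ * z ∣ ≡ ∣ z ∣
  IsSign⇒∣*∣ {σ} s z = trans (ℤP.abs-* σ z) (trans (cong (ℕ._* ∣ z ∣) (IsSign⇒∣∣≡1 s)) (ℕP.*-identityˡ ∣ z ∣))

  ∣L+σ∣≤1+L : ∀ L {σ} → IsSign σ → ∣ + L + σ ∣ ≤ suc L
  ∣L+σ∣≤1+L L {σ} s =
    ℕP.≤-trans (ℤP.∣i+j∣≤∣i∣+∣j∣ (+ L) σ) (ℕP.≤-reflexive (trans (cong (L ℕ.+_) (IsSign⇒∣∣≡1 s)) (ℕP.+-comm L 1)))

  ∣L-σ∣≤1+L : ∀ L {σ} → IsSign σ → ∣ + L - σ ∣ ≤ suc L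
  ∣L-σ∣≤1+L L {σ} s =
    ℕP.≤-trans (ℤP.∣i-j∣≤∣i∣+∣j∣ (+ L) σ) (ℕP.≤-reflexive (trans (cong (L ℕ.+_) (IsSign⇒∣∣≡1 s)) (ℕP.+-comm L 1)))

  ∣m-n∣≤ : ∀ a b c → a ≤ c → b ≤ c → ∣ + a - + b ∣ ≤ c
  ∣m-n∣≤ a b c ac bc rewrite ℤP.m-n≡m⊖n a b = ℕP.≤-trans (ℤP.∣m⊝n∣≤m⊔n a b) (ℕP.⊔-lub ac bc)

  signum : ℤ → ℤ
  signum (+ _) = + 1
  signum ℤ.-[1+ _ ] = - + 1

  signum-isSign : ∀ z → IsSign (signum z)
  signum-isSign (+ _) = inj₁ refl
  signum-isSign ℤ.-[1+ _ ] = inj₂ refl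

  signum-* : ∀ z → signum z * z ≡ + ∣ z ∣
  signum-* (+ n) = ℤP.*-identityˡ (+ n)
  signum-* ℤ.-[1+ n ] = ℤP.-1*i≡-i ℤ.-[1+ n ]

  -- One-dimensional Riesz products

  module Riesz₁ (L' : ℕ) (s : ℕ → ℕ → ℤ) (s-isSign : ∀ k b → IsSign (s k b)) where

    L : ℕ
    L = suc L'

    riesz : ℕ → ℕ → ℤ
    riesz zero u = + 1
    riesz (suc K) u = riesz K u * (+ L + s K (half^ (suc K) u) * −1^ (half^ K u))

    riesz-nonneg : ∀ K u → ∃ λ n → riesz K u ≡ + n
    riesz-nonneg zero u = 1 , refl
    riesz-nonneg (suc K) u with riesz-nonneg K u | IsSign-* (s-isSign K (half^ (suc K) u)) (−1^-isSign (half^ K u))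
    ... | n , eq | inj₁ σ≡1 =
      n ℕ.* (L ℕ.+ 1) , trans (cong₂ _*_ eq (cong (_+_ (+ L)) σ≡1)) (trans (cong (+ n *_) (sym (ℤP.pos-+ L 1))) (sym (ℤP.pos-* n _)))
    ... | n , eq | inj₂ σ≡-1 =
      n ℕ.* L' , trans (cong₂ _*_ eq (cong (_+_ (+ L)) σ≡-1)) (sym (ℤP.pos-* n L'))

    riesz-lower : ∀ K b t → t < 2 ^ K →
      riesz (suc K) (b ℕ.* 2 ^ suc K ℕ.+ t) ≡ riesz K ((2 ℕ.* b) ℕ.* 2 ^ K ℕ.+ t) * (+ L + s K b)
    riesz-lower K b t lt
      rewrite half^-block (suc K) b t (ℕP.<-≤-trans lt (ℕP.m≤m+n _ _))
            | −1^-lower K b t lt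
            | ℤP.*-identityʳ (s K b)
            | block-lower b (2 ^ K) t = refl

    riesz-upper : ∀ K b t → t < 2 ^ K →
      riesz (suc K) (b ℕ.* 2 ^ suc K ℕ.+ (2 ^ K ℕ.+ t)) ≡ riesz K ((2 ℕ.* b ℕ.+ 1) ℕ.* 2 ^ K ℕ.+ t) * (+ L - s K b)
    riesz-upper K b t lt
      rewrite half^-block (suc K) b (2 ^ K ℕ.+ t) (subst (2 ^ K ℕ.+ t <_) (sym (2^suc K)) (ℕP.+-monoʳ-< (2 ^ K) lt))
            | −1^-upper K b t lt
            | ℤP.*-comm (s K b) (- + 1)
            | ℤP.-1*i≡-i (s K b)
            | block-upper b (2 ^ K) t = refl

    blockSum : ℕ → ℕ → ℕ → ℤ
    blockSum K b w = Σℤ (2 ^ K) (λ t → 𝟙[ w ≤ t ] * riesz K (b ℕ.* 2 ^ K ℕ.+ t))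

    blockSum-step : ∀ K b w → blockSum (suc K) b w ≡
      (+ L + s K b) * blockSum K (2 ℕ.* b) w + (+ L - s K b) * blockSum K (2 ℕ.* b ℕ.+ 1) (w ∸ 2 ^ K)
    blockSum-step K b w = begin
        Σℤ (2 ^ suc K) F                                   ≡⟨ cong (λ n → Σℤ n F) (2^suc K) ⟩
        Σℤ (p ℕ.+ p) F                                     ≡⟨ Σℤ-split p p F ⟩
        Σℤ p F + Σℤ p (λ t → F (p ℕ.+ t))                  ≡⟨ cong₂ _+_ (Σℤ-cong p lower) (Σℤ-cong p upper) ⟩
        Σℤ p (λ t → (+ L + s K b) * G₀ t) + Σℤ p (λ t → (+ L - s K b) * G₁ t)
          ≡⟨ cong₂ _+_ (Σℤ-*ˡ p (+ L + s K b) G₀) (Σℤ-*ˡ p (+ L - s K b) G₁) ⟩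
        (+ L + s K b) * blockSum K (2 ℕ.* b) w + (+ L - s K b) * blockSum K (2 ℕ.* b ℕ.+ 1) (w ∸ p) ∎
      where
      open ≡-Reasoning
      p = 2 ^ K
      F = λ t → 𝟙[ w ≤ t ] * riesz (suc K) (b ℕ.* 2 ^ suc K ℕ.+ t)
      G₀ = λ t → 𝟙[ w ≤ t ] * riesz K ((2 ℕ.* b) ℕ.* p ℕ.+ t)
      G₁ = λ t → 𝟙[ w ∸ p ≤ t ] * riesz K ((2 ℕ.* b ℕ.+ 1) ℕ.* p ℕ.+ t)
      pull : ∀ i r c → i * (r * c) ≡ c * (i * r)
      pull = ℤ-Solver.solve-∀
      lower : ∀ t → t < p → F t ≡ (+ L + s K b) * G₀ t
      lower t lt = trans (cong (𝟙[ w ≤ t ] *_) (riesz-lower K b t lt)) (pull 𝟙[ w ≤ t ] _ (+ L + s K b))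
      upper : ∀ t → t < p → F (p ℕ.+ t) ≡ (+ L - s K b) * G₁ t
      upper t lt = trans (cong₂ _*_ (𝟙-shift p w t) (riesz-upper K b t lt)) (pull 𝟙[ w ∸ p ≤ t ] _ (+ L - s K b))

    blockSum-full : ∀ K b → blockSum K b 0 ≡ + (2 ^ K ℕ.* L ^ K)
    blockSum-full zero b = refl
    blockSum-full (suc K) b = begin
        blockSum (suc K) b 0
          ≡⟨ blockSum-step K b 0 ⟩
        (+ L + s K b) * blockSum K (2 ℕ.* b) 0 + (+ L - s K b) * blockSum K (2 ℕ.* b ℕ.+ 1) (0 ∸ 2 ^ K)
          ≡⟨ cong (λ z → (+ L + s K b) * blockSum K (2 ℕ.* b) 0 + (+ L - s K b) * blockSum K (2 ℕ.* b ℕ.+ 1) z) (ℕP.0∸n≡0 (2 ^ K)) ⟩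
        (+ L + s K b) * blockSum K (2 ℕ.* b) 0 + (+ L - s K b) * blockSum K (2 ℕ.* b ℕ.+ 1) 0
          ≡⟨ cong₂ (λ x y → (+ L + s K b) * x + (+ L - s K b) * y) (blockSum-full K (2 ℕ.* b)) (blockSum-full K (2 ℕ.* b ℕ.+ 1)) ⟩
        (+ L + s K b) * X + (+ L - s K b) * X
          ≡⟨ cancel (+ L) (s K b) X ⟩
        (+ 2 * + L) * X
          ≡⟨ trans (sym (ℤP.pos-* (2 ℕ.* L) (2 ^ K ℕ.* L ^ K))) (cong +_ (regroup L (2 ^ K) (L ^ K))) ⟩
        + (2 ^ suc K ℕ.* L ^ suc K) ∎
      where
      open ≡-Reasoning
      X = + (2 ^ K ℕ.* L ^ K)
      cancel : ∀ l σ x → (l + σ) * x + (l - σ) * x ≡ (+ 2 * l) * x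
      cancel = ℤ-Solver.solve-∀
      regroup : ∀ l p q → (2 ℕ.* l) ℕ.* (p ℕ.* q) ≡ (2 ℕ.* p) ℕ.* (l ℕ.* q)
      regroup = ℕ-Solver.solve-∀

    blockSum-empty : ∀ K b w → 2 ^ K ≤ w → blockSum K b w ≡ + 0
    blockSum-empty K b w p≤w = Σℤ-vanish (2 ^ K) _ (λ t lt →
      trans (cong (_* riesz K (b ℕ.* 2 ^ K ℕ.+ t)) (𝟙-< w t (ℕP.<-≤-trans lt p≤w))) (ℤP.*-zeroˡ (riesz K (b ℕ.* 2 ^ K ℕ.+ t))))

    blockError : ℕ → ℕ → ℕ → ℤ
    blockError K b w = blockSum K b w - + (L ^ K ℕ.* (2 ^ K ∸ w))

    blockError-full : ∀ K b → blockError K b 0 ≡ + 0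
    blockError-full K b rewrite blockSum-full K b | ℕP.*-comm (L ^ K) (2 ^ K) = ℤP.+-inverseʳ (+ (2 ^ K ℕ.* L ^ K))

    blockError-empty : ∀ K b w → 2 ^ K ≤ w → blockError K b w ≡ + 0
    blockError-empty K b w p≤w rewrite blockSum-empty K b w p≤w | ℕP.m≤n⇒m∸n≡0 p≤w | ℕP.*-zeroʳ (L ^ K) = refl

    blockError-step : ∀ K b w → blockError (suc K) b w ≡
      (+ L + s K b) * blockError K (2 ℕ.* b) w + (+ L - s K b) * blockError K (2 ℕ.* b ℕ.+ 1) (w ∸ 2 ^ K)
        + s K b * (+ (L ^ K ℕ.* (2 ^ K ∸ w)) - + (L ^ K ℕ.* (2 ^ K ∸ (w ∸ 2 ^ K))))
    blockError-step K b w = begin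
        blockSum (suc K) b w - + (L ^ suc K ℕ.* (2 ^ suc K ∸ w))
          ≡⟨ cong₂ _-_ (blockSum-step K b w) full ⟩
        (+ L + s K b) * blockSum K (2 ℕ.* b) w + (+ L - s K b) * blockSum K (2 ℕ.* b ℕ.+ 1) (w ∸ p) - + L * (+ A₀ + + A₁)
          ≡⟨ rearrange (+ L) (s K b) (blockSum K (2 ℕ.* b) w) (blockSum K (2 ℕ.* b ℕ.+ 1) (w ∸ p)) (+ A₀) (+ A₁) ⟩
        (+ L + s K b) * blockError K (2 ℕ.* b) w + (+ L - s K b) * blockError K (2 ℕ.* b ℕ.+ 1) (w ∸ p)
          + s K b * (+ A₀ - + A₁) ∎
      where
      open ≡-Reasoning
      p = 2 ^ K
      A₀ = L ^ K ℕ.* (p ∸ w)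
      A₁ = L ^ K ℕ.* (p ∸ (w ∸ p))
      distrib : ∀ l q a b → (l ℕ.* q) ℕ.* (a ℕ.+ b) ≡ l ℕ.* (q ℕ.* a ℕ.+ q ℕ.* b)
      distrib = ℕ-Solver.solve-∀
      full : + (L ^ suc K ℕ.* (2 ^ suc K ∸ w)) ≡ + L * (+ A₀ + + A₁)
      full = begin
          + ((L ℕ.* L ^ K) ℕ.* (2 ^ suc K ∸ w))              ≡⟨ cong (λ z → + ((L ℕ.* L ^ K) ℕ.* (z ∸ w))) (2^suc K) ⟩
          + ((L ℕ.* L ^ K) ℕ.* ((p ℕ.+ p) ∸ w))              ≡⟨ cong (λ z → + ((L ℕ.* L ^ K) ℕ.* z)) (sym (∸-halves p w)) ⟩
          + ((L ℕ.* L ^ K) ℕ.* ((p ∸ w) ℕ.+ (p ∸ (w ∸ p))))  ≡⟨ cong +_ (distrib L (L ^ K) (p ∸ w) (p ∸ (w ∸ p))) ⟩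
          + (L ℕ.* (A₀ ℕ.+ A₁))                              ≡⟨ ℤP.pos-* L (A₀ ℕ.+ A₁) ⟩
          + L * + (A₀ ℕ.+ A₁)                                ≡⟨ cong (+ L *_) (ℤP.pos-+ A₀ A₁) ⟩
          + L * (+ A₀ + + A₁) ∎
      rearrange : ∀ l σ s₀ s₁ a₀ a₁ →
        (l + σ) * s₀ + (l - σ) * s₁ - l * (a₀ + a₁) ≡ (l + σ) * (s₀ - a₀) + (l - σ) * (s₁ - a₁) + σ * (a₀ - a₁)
      rearrange = ℤ-Solver.solve-∀

    blockError-step-bound : ∀ K b w → ∣ blockError (suc K) b w ∣ ≤
      (2 ℕ.+ L') ℕ.* (∣ blockError K (2 ℕ.* b) w ∣ ℕ.+ ∣ blockError K (2 ℕ.* b ℕ.+ 1) (w ∸ 2 ^ K) ∣) ℕ.+ 2 ^ K ℕ.* L ^ K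
    blockError-step-bound K b w = begin
        ∣ blockError (suc K) b w ∣
          ≡⟨ cong ∣_∣ (blockError-step K b w) ⟩
        ∣ (+ L + σ) * E₀ + (+ L - σ) * E₁ + σ * d ∣
          ≤⟨ ℤP.∣i+j∣≤∣i∣+∣j∣ ((+ L + σ) * E₀ + (+ L - σ) * E₁) (σ * d) ⟩
        ∣ (+ L + σ) * E₀ + (+ L - σ) * E₁ ∣ ℕ.+ ∣ σ * d ∣
          ≤⟨ ℕP.+-mono-≤ (ℤP.∣i+j∣≤∣i∣+∣j∣ ((+ L + σ) * E₀) ((+ L - σ) * E₁)) (ℕP.≤-reflexive (IsSign⇒∣*∣ (s-isSign K b) d)) ⟩
        ∣ (+ L + σ) * E₀ ∣ ℕ.+ ∣ (+ L - σ) * E₁ ∣ ℕ.+ ∣ d ∣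
          ≡⟨ cong₂ (λ x y → x ℕ.+ y ℕ.+ ∣ d ∣) (ℤP.abs-* (+ L + σ) E₀) (ℤP.abs-* (+ L - σ) E₁) ⟩
        ∣ + L + σ ∣ ℕ.* ∣ E₀ ∣ ℕ.+ ∣ + L - σ ∣ ℕ.* ∣ E₁ ∣ ℕ.+ ∣ d ∣
          ≤⟨ ℕP.+-mono-≤ (ℕP.+-mono-≤ (ℕP.*-monoˡ-≤ ∣ E₀ ∣ (∣L+σ∣≤1+L L (s-isSign K b)))
                                      (ℕP.*-monoˡ-≤ ∣ E₁ ∣ (∣L-σ∣≤1+L L (s-isSign K b))))
                         (∣m-n∣≤ _ _ _ (bound (2 ^ K ∸ w) (ℕP.m∸n≤m _ w)) (bound (2 ^ K ∸ (w ∸ 2 ^ K)) (ℕP.m∸n≤m _ (w ∸ 2 ^ K)))) ⟩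
        (2 ℕ.+ L') ℕ.* ∣ E₀ ∣ ℕ.+ (2 ℕ.+ L') ℕ.* ∣ E₁ ∣ ℕ.+ 2 ^ K ℕ.* L ^ K
          ≡⟨ cong (ℕ._+ 2 ^ K ℕ.* L ^ K) (sym (ℕP.*-distribˡ-+ (2 ℕ.+ L') ∣ E₀ ∣ ∣ E₁ ∣)) ⟩
        (2 ℕ.+ L') ℕ.* (∣ E₀ ∣ ℕ.+ ∣ E₁ ∣) ℕ.+ 2 ^ K ℕ.* L ^ K ∎
      where
      open ℕP.≤-Reasoning
      σ = s K b
      E₀ = blockError K (2 ℕ.* b) w
      E₁ = blockError K (2 ℕ.* b ℕ.+ 1) (w ∸ 2 ^ K)
      d = + (L ^ K ℕ.* (2 ^ K ∸ w)) - + (L ^ K ℕ.* (2 ^ K ∸ (w ∸ 2 ^ K)))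
      bound : ∀ a → a ≤ 2 ^ K → L ^ K ℕ.* a ≤ 2 ^ K ℕ.* L ^ K
      bound a a≤ = subst (L ^ K ℕ.* a ≤_) (ℕP.*-comm (L ^ K) (2 ^ K)) (ℕP.*-monoʳ-≤ (L ^ K) a≤)

    blockError-bound : ∀ K b w → L' ℕ.* ∣ blockError K b w ∣ ≤ 2 ^ K ℕ.* L ^ K
    blockError-bound zero b zero = ℕP.≤-trans (ℕP.≤-reflexive (ℕP.*-zeroʳ L')) z≤n
    blockError-bound zero b (suc w) rewrite ℕP.0∸n≡0 w = ℕP.≤-trans (ℕP.≤-reflexive (ℕP.*-zeroʳ L')) z≤n
    blockError-bound (suc K) b w = begin
        L' ℕ.* ∣ blockError (suc K) b w ∣
          ≤⟨ ℕP.*-monoʳ-≤ L' (blockError-step-bound K b w) ⟩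
        L' ℕ.* ((2 ℕ.+ L') ℕ.* e ℕ.+ 2 ^ K ℕ.* L ^ K)
          ≡⟨ distrib L' e (2 ^ K ℕ.* L ^ K) ⟩
        (2 ℕ.+ L') ℕ.* (L' ℕ.* e) ℕ.+ L' ℕ.* (2 ^ K ℕ.* L ^ K)
          ≤⟨ ℕP.+-monoˡ-≤ _ (ℕP.*-monoʳ-≤ (2 ℕ.+ L') halves) ⟩
        (2 ℕ.+ L') ℕ.* (2 ^ K ℕ.* L ^ K) ℕ.+ L' ℕ.* (2 ^ K ℕ.* L ^ K)
          ≡⟨ collect L' (2 ^ K) (L ^ K) ⟩
        (2 ^ K ℕ.+ 2 ^ K) ℕ.* L ^ suc K
          ≡⟨ cong (ℕ._* L ^ suc K) (sym (2^suc K)) ⟩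
        2 ^ suc K ℕ.* L ^ suc K ∎
      where
      open ℕP.≤-Reasoning
      e = ∣ blockError K (2 ℕ.* b) w ∣ ℕ.+ ∣ blockError K (2 ℕ.* b ℕ.+ 1) (w ∸ 2 ^ K) ∣
      distrib : ∀ l e q → l ℕ.* ((2 ℕ.+ l) ℕ.* e ℕ.+ q) ≡ (2 ℕ.+ l) ℕ.* (l ℕ.* e) ℕ.+ l ℕ.* q
      distrib = ℕ-Solver.solve-∀
      collect : ∀ l p q → (2 ℕ.+ l) ℕ.* (p ℕ.* q) ℕ.+ l ℕ.* (p ℕ.* q) ≡ (p ℕ.+ p) ℕ.* ((1 ℕ.+ l) ℕ.* q)
      collect = ℕ-Solver.solve-∀
      halves : L' ℕ.* e ≤ 2 ^ K ℕ.* L ^ K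
      halves with ℕP.≤-total w (2 ^ K)
      ... | inj₁ w≤p rewrite ℕP.m≤n⇒m∸n≡0 w≤p | blockError-full K (2 ℕ.* b ℕ.+ 1) | ℕP.+-identityʳ ∣ blockError K (2 ℕ.* b) w ∣ =
        blockError-bound K (2 ℕ.* b) w
      ... | inj₂ p≤w rewrite blockError-empty K (2 ℕ.* b) w p≤w = blockError-bound K (2 ℕ.* b ℕ.+ 1) (w ∸ 2 ^ K)

    haarSum : ℕ → ℕ → ℕ → ℤ
    haarSum K α w =
      Σℤ (2 ^ suc K) (λ t → 𝟙[ w ≤ t ] * (riesz K (α ℕ.* 2 ^ suc K ℕ.+ t) * −1^ (half^ K (α ℕ.* 2 ^ suc K ℕ.+ t))))

    haarSum-split : ∀ K α w → haarSum K α w ≡ blockSum K (2 ℕ.* α) w - blockSum K (2 ℕ.* α ℕ.+ 1) (w ∸ 2 ^ K)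
    haarSum-split K α w = begin
        Σℤ (2 ^ suc K) F                                   ≡⟨ cong (λ n → Σℤ n F) (2^suc K) ⟩
        Σℤ (p ℕ.+ p) F                                     ≡⟨ Σℤ-split p p F ⟩
        Σℤ p F + Σℤ p (λ t → F (p ℕ.+ t))                  ≡⟨ cong₂ _+_ (Σℤ-cong p lower) (Σℤ-cong p upper) ⟩
        blockSum K (2 ℕ.* α) w + Σℤ p (λ t → - G₁ t)        ≡⟨ cong (_+_ (blockSum K (2 ℕ.* α) w)) (Σℤ-neg p G₁) ⟩
        blockSum K (2 ℕ.* α) w - blockSum K (2 ℕ.* α ℕ.+ 1) (w ∸ p) ∎
      where
      open ≡-Reasoning
      p = 2 ^ K
      F = λ t → 𝟙[ w ≤ t ] * (riesz K (α ℕ.* 2 ^ suc K ℕ.+ t) * −1^ (half^ K (α ℕ.* 2 ^ suc K ℕ.+ t)))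
      G₁ = λ t → 𝟙[ w ∸ p ≤ t ] * riesz K ((2 ℕ.* α ℕ.+ 1) ℕ.* p ℕ.+ t)
      lower : ∀ t → t < p → F t ≡ 𝟙[ w ≤ t ] * riesz K ((2 ℕ.* α) ℕ.* p ℕ.+ t)
      lower t lt rewrite −1^-lower K α t lt | ℤP.*-identityʳ (riesz K (α ℕ.* 2 ^ suc K ℕ.+ t)) | block-lower α p t = refl
      upper : ∀ t → t < p → F (p ℕ.+ t) ≡ - G₁ t
      upper t lt rewrite −1^-upper K α t lt | 𝟙-shift p w t | block-upper α p t = negate 𝟙[ w ∸ p ≤ t ] (riesz K ((2 ℕ.* α ℕ.+ 1) ℕ.* p ℕ.+ t))
        where
        negate : ∀ i r → i * (r * - + 1) ≡ - (i * r)
        negate = ℤ-Solver.solve-∀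

    haarSum-full : ∀ K α → haarSum K α 0 ≡ + 0
    haarSum-full K α rewrite haarSum-split K α 0 | ℕP.0∸n≡0 (2 ^ K)
                           | blockSum-full K (2 ℕ.* α) | blockSum-full K (2 ℕ.* α ℕ.+ 1) =
      ℤP.+-inverseʳ (+ (2 ^ K ℕ.* L ^ K))

    haarSum-empty : ∀ K α w → 2 ^ suc K ≤ w → haarSum K α w ≡ + 0
    haarSum-empty K α w le = Σℤ-vanish (2 ^ suc K) _ (λ t lt →
      trans (cong (_* _) (𝟙-< w t (ℕP.<-≤-trans lt le))) (ℤP.*-zeroˡ (riesz K (α ℕ.* 2 ^ suc K ℕ.+ t) * −1^ (half^ K (α ℕ.* 2 ^ suc K ℕ.+ t)))))

    haarSum≈tent : ∀ K α w → L' ℕ.* ∣ haarSum K α w + + (L ^ K ℕ.* tent (2 ^ suc K) w) ∣ ≤ 2 ^ suc K ℕ.* L ^ K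
    haarSum≈tent K α w = begin
        L' ℕ.* ∣ haarSum K α w + + (L ^ K ℕ.* tent (2 ^ suc K) w) ∣
          ≡⟨ cong (λ z → L' ℕ.* ∣ z ∣) errors ⟩
        L' ℕ.* ∣ E₀ - E₁ ∣
          ≤⟨ ℕP.*-monoʳ-≤ L' (ℤP.∣i-j∣≤∣i∣+∣j∣ E₀ E₁) ⟩
        L' ℕ.* (∣ E₀ ∣ ℕ.+ ∣ E₁ ∣)
          ≡⟨ ℕP.*-distribˡ-+ L' ∣ E₀ ∣ ∣ E₁ ∣ ⟩
        L' ℕ.* ∣ E₀ ∣ ℕ.+ L' ℕ.* ∣ E₁ ∣
          ≤⟨ ℕP.+-mono-≤ (blockError-bound K (2 ℕ.* α) w) (blockError-bound K (2 ℕ.* α ℕ.+ 1) (w ∸ p)) ⟩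
        p ℕ.* L ^ K ℕ.+ p ℕ.* L ^ K
          ≡⟨ trans (sym (ℕP.*-distribʳ-+ (L ^ K) p p)) (cong (ℕ._* L ^ K) (sym (2^suc K))) ⟩
        2 ^ suc K ℕ.* L ^ K ∎
      where
      open ℕP.≤-Reasoning
      p = 2 ^ K
      E₀ = blockError K (2 ℕ.* α) w
      E₁ = blockError K (2 ℕ.* α ℕ.+ 1) (w ∸ p)
      A₀ = L ^ K ℕ.* (p ∸ w)
      A₁≡ : L ^ K ℕ.* (p ∸ (w ∸ p)) ≡ A₀ ℕ.+ L ^ K ℕ.* tent (2 ^ suc K) w
      A₁≡ = trans (cong (L ^ K ℕ.*_) (trans (sym (∸-tent p w)) (cong (λ M → (p ∸ w) ℕ.+ tent M w) (sym (2^suc K)))))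
                  (ℕP.*-distribˡ-+ (L ^ K) (p ∸ w) _)
      rearrange : ∀ s₀ s₁ a m → s₀ - s₁ + m ≡ (s₀ - a) - (s₁ - (a + m))
      rearrange = ℤ-Solver.solve-∀
      errors : haarSum K α w + + (L ^ K ℕ.* tent (2 ^ suc K) w) ≡ E₀ - E₁
      errors rewrite haarSum-split K α w | A₁≡ | ℤP.pos-+ A₀ (L ^ K ℕ.* tent (2 ^ suc K) w) =
        rearrange (blockSum K (2 ℕ.* α) w) (blockSum K (2 ℕ.* α ℕ.+ 1) (w ∸ p)) (+ A₀) _

  -- Canonical cells

  T⇒≡true : ∀ {b} → T b → b ≡ true
  T⇒≡true = Equivalence.to BoolP.T-≡

  ≡true⇒T : ∀ {b} → b ≡ true → T b
  ≡true⇒T = Equivalence.from BoolP.T-≡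

  inInterval : ℕ → ℕ → ℕ → Bool
  inInterval k i x = (i ℕ.* 2 ^ k ≤ᵇ x) ∧ (x <ᵇ suc i ℕ.* 2 ^ k)

  inCell-product : ∀ m K i j x y → inCell m K i j x y ≡ inInterval K i x ∧ inInterval (m ∸ K) j y
  inCell-product m K i j x y = sym (BoolP.∧-assoc (i ℕ.* 2 ^ K ≤ᵇ x) (x <ᵇ suc i ℕ.* 2 ^ K) (inInterval (m ∸ K) j y))

  half^-start≤ : ∀ k x → half^ k x ℕ.* 2 ^ k ≤ x
  half^-start≤ k x with half^-divMod k x
  ... | r , _ , eq = subst (half^ k x ℕ.* 2 ^ k ≤_) (sym eq) (ℕP.m≤m+n _ r)

  inInterval-half^ : ∀ k x → inInterval k (half^ k x) x ≡ true
  inInterval-half^ k x with half^-divMod k x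
  ... | r , r< , eq = cong₂ _∧_ (T⇒≡true (ℕP.≤⇒≤ᵇ (half^-start≤ k x))) (T⇒≡true (ℕP.<⇒<ᵇ x<end))
    where
    x<end : x < suc (half^ k x) ℕ.* 2 ^ k
    x<end = subst (_< suc (half^ k x) ℕ.* 2 ^ k) (sym eq)
              (ℕP.<-≤-trans (ℕP.+-monoʳ-< (half^ k x ℕ.* 2 ^ k) r<) (ℕP.≤-reflexive (ℕP.+-comm _ (2 ^ k))))

  inInterval-other : ∀ k i x → i ≢ half^ k x → inInterval k i x ≡ false
  inInterval-other k i x i≢ with i ℕ.* 2 ^ k ≤ᵇ x in start≤ | x <ᵇ suc i ℕ.* 2 ^ k in <end
  ... | false | _ = refl
  ... | true | false = refl
  ... | true | true = ⊥-elim (i≢ (sym (trans (cong (half^ k) (sym x≡)) (half^-block k i (x ∸ i ℕ.* 2 ^ k) offset<))))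
    where
    x≡ : i ℕ.* 2 ^ k ℕ.+ (x ∸ i ℕ.* 2 ^ k) ≡ x
    x≡ = ℕP.m+[n∸m]≡n (ℕP.≤ᵇ⇒≤ (i ℕ.* 2 ^ k) x (≡true⇒T start≤))
    offset< : x ∸ i ℕ.* 2 ^ k < 2 ^ k
    offset< = ℕP.+-cancelˡ-< (i ℕ.* 2 ^ k) _ _
      (subst (_< i ℕ.* 2 ^ k ℕ.+ 2 ^ k) (sym x≡)
        (subst (x <_) (ℕP.+-comm (2 ^ k) (i ℕ.* 2 ^ k)) (ℕP.<ᵇ⇒< _ _ (≡true⇒T <end))))

  nearestSide≡tent : ∀ k x →
    (2 ℕ.* x ℕ.+ 1 ∸ 2 ℕ.* (half^ k x ℕ.* 2 ^ k)) ℕ.⊓ (2 ℕ.* (suc (half^ k x) ℕ.* 2 ^ k) ∸ (2 ℕ.* x ℕ.+ 1))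
      ≡ tent (2 ^ suc k) (2 ℕ.* x ℕ.+ 1 ∸ half^ k x ℕ.* 2 ^ suc k)
  nearestSide≡tent k x =
    cong₂ ℕ._⊓_ (cong (U ∸_) start) (trans (cong (_∸ U) end) (trans (cong ((B ℕ.+ M) ∸_) (sym (ℕP.m+[n∸m]≡n B≤U))) (ℕP.[m+n]∸[m+o]≡n∸o B M (U ∸ B))))
    where
    i = half^ k x
    U = 2 ℕ.* x ℕ.+ 1
    B = i ℕ.* 2 ^ suc k
    M = 2 ^ suc k
    start-eq : ∀ i p → 2 ℕ.* (i ℕ.* p) ≡ i ℕ.* (2 ℕ.* p)
    start-eq = ℕ-Solver.solve-∀
    end-eq : ∀ i p → 2 ℕ.* ((1 ℕ.+ i) ℕ.* p) ≡ i ℕ.* (2 ℕ.* p) ℕ.+ 2 ℕ.* p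
    end-eq = ℕ-Solver.solve-∀
    start : 2 ℕ.* (i ℕ.* 2 ^ k) ≡ B
    start = start-eq i (2 ^ k)
    end : 2 ℕ.* (suc i ℕ.* 2 ^ k) ≡ B ℕ.+ M
    end = end-eq i (2 ^ k)
    B≤U : B ≤ U
    B≤U = ℕP.≤-trans (ℕP.≤-reflexive (sym start)) (ℕP.≤-trans (ℕP.*-monoʳ-≤ 2 (half^-start≤ k x)) (ℕP.m≤m+n (2 ℕ.* x) 1))

  cornerVol4≡tent*tent : ∀ m K x y → cornerVol4 m K (half^ K x) (half^ (m ∸ K) y) x y ≡
     tent (2 ^ suc K) (2 ℕ.* x ℕ.+ 1 ∸ half^ K x ℕ.* 2 ^ suc K) ℕ.*
     tent (2 ^ suc (m ∸ K)) (2 ℕ.* y ℕ.+ 1 ∸ half^ (m ∸ K) y ℕ.* 2 ^ suc (m ∸ K))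
  cornerVol4≡tent*tent m K x y = cong₂ ℕ._*_ (nearestSide≡tent K x) (nearestSide≡tent (m ∸ K) y)

  Σ-by-cells : ∀ m K → K ≤ m → (F : ℕ → ℕ → ℕ → ℕ → ℤ) →
    Σℤ (2 ^ m) (λ x → Σℤ (2 ^ m) (λ y → F (half^ K x) (half^ (m ∸ K) y) x y)) ≡
    Σℤ (2 ^ (m ∸ K)) (λ i → Σℤ (2 ^ K) (λ j →
      Σℤ (2 ^ m) (λ x → Σℤ (2 ^ m) (λ y → if inCell m K i j x y then F i j x y else + 0))))
  Σ-by-cells m K K≤m F = sym (begin
      Σℤ A (λ i → Σℤ B (λ j → Σℤ n (λ x → Σℤ n (λ y → H i j x y))))
    ≡⟨ Σℤ-cong A (λ i _ → Σℤ-swap B n (λ j x → Σℤ n (λ y → H i j x y))) ⟩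
      Σℤ A (λ i → Σℤ n (λ x → Σℤ B (λ j → Σℤ n (λ y → H i j x y))))
    ≡⟨ Σℤ-swap A n (λ i x → Σℤ B (λ j → Σℤ n (λ y → H i j x y))) ⟩
      Σℤ n (λ x → Σℤ A (λ i → Σℤ B (λ j → Σℤ n (λ y → H i j x y))))
    ≡⟨ Σℤ-cong n (λ x _ → Σℤ-cong A (λ i _ → Σℤ-swap B n (λ j y → H i j x y))) ⟩
      Σℤ n (λ x → Σℤ A (λ i → Σℤ n (λ y → Σℤ B (λ j → H i j x y))))
    ≡⟨ Σℤ-cong n (λ x _ → Σℤ-swap A n (λ i y → Σℤ B (λ j → H i j x y))) ⟩
      Σℤ n (λ x → Σℤ n (λ y → Σℤ A (λ i → Σℤ B (λ j → H i j x y))))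
    ≡⟨ Σℤ-cong n (λ x x< → Σℤ-cong n (λ y y< → onlyOwnCell x y x< y<)) ⟩
      Σℤ n (λ x → Σℤ n (λ y → F (half^ K x) (half^ (m ∸ K) y) x y)) ∎)
    where
    open ≡-Reasoning
    n = 2 ^ m
    A = 2 ^ (m ∸ K)
    B = 2 ^ K
    H = λ i j x y → if inCell m K i j x y then F i j x y else + 0
    n≡A*B : n ≡ A ℕ.* B
    n≡A*B = trans (cong (2 ^_) (sym (ℕP.m∸n+n≡m K≤m))) (ℕP.^-distribˡ-+-* 2 (m ∸ K) K)
    H≡ : ∀ i j x y → inInterval K i x ∧ inInterval (m ∸ K) j y ≡ false → H i j x y ≡ + 0
    H≡ i j x y e = cong (λ b → if b then F i j x y else + 0) (trans (inCell-product m K i j x y) e)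
    onlyOwnCell : ∀ x y → x < n → y < n → Σℤ A (λ i → Σℤ B (λ j → H i j x y)) ≡ F (half^ K x) (half^ (m ∸ K) y) x y
    onlyOwnCell x y x< y< =
      trans (Σℤ-single A _ i₀ i₀< otherColumn) (trans (Σℤ-single B _ j₀ j₀< otherRow) ownCell)
      where
      i₀ = half^ K x
      j₀ = half^ (m ∸ K) y
      i₀< : i₀ < A
      i₀< = half^-< K x A (subst (x <_) n≡A*B x<)
      j₀< : j₀ < B
      j₀< = half^-< (m ∸ K) y B (subst (y <_) (trans n≡A*B (ℕP.*-comm A B)) y<)
      otherColumn : ∀ i → i < A → i ≢ i₀ → Σℤ B (λ j → H i j x y) ≡ + 0
      otherColumn i _ i≢ = Σℤ-vanish B _ (λ j _ → H≡ i j x y (cong (_∧ inInterval (m ∸ K) j y) (inInterval-other K i x i≢)))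
      otherRow : ∀ j → j < B → j ≢ j₀ → H i₀ j x y ≡ + 0
      otherRow j _ j≢ = H≡ i₀ j x y (trans (cong (_∧ inInterval (m ∸ K) j y) (inInterval-half^ K x)) (inInterval-other (m ∸ K) j y j≢))
      ownCell : H i₀ j₀ x y ≡ F i₀ j₀ x y
      ownCell = cong (λ b → if b then F i₀ j₀ x y else + 0)
                  (trans (inCell-product m K i₀ j₀ x y) (cong₂ _∧_ (inInterval-half^ K x) (inInterval-half^ (m ∸ K) y)))

  -- Two-dimensional Riesz products

  Σℤ-one-block : ∀ B M (g Q : ℕ → ℤ) j → j < B →
    (∀ β → Σℤ M (λ t → g (β ℕ.* M ℕ.+ t)) ≡ Q β) → (∀ β → β < B → β ≢ j → Q β ≡ + 0) →
    Σℤ (B ℕ.* M) g ≡ Q j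
  Σℤ-one-block B M g Q j j<B block others =
    trans (Σℤ-blocks B M g) (trans (Σℤ-cong B (λ β _ → block β)) (Σℤ-single B Q j j<B others))

  offset-outside : ∀ k V β → β ≢ half^ k V → (V ∸ β ℕ.* 2 ^ k ≡ 0) ⊎ (2 ^ k ≤ V ∸ β ℕ.* 2 ^ k)
  offset-outside k V β β≢ with half^-divMod k V | ℕP.<-cmp β (half^ k V)
  ... | _ | tri≈ _ β≡ _ = ⊥-elim (β≢ β≡)
  ... | r , r< , V≡ | tri< β<j _ _ =
    inj₂ (ℕP.≤-trans (ℕP.≤-reflexive (sym (ℕP.m+n∸m≡n (β ℕ.* M) M))) (ℕP.∸-monoˡ-≤ (β ℕ.* M) next≤V))
    where
    M = 2 ^ k
    next≤V : β ℕ.* M ℕ.+ M ≤ V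
    next≤V = ℕP.≤-trans (ℕP.≤-reflexive (ℕP.+-comm (β ℕ.* M) M))
               (ℕP.≤-trans (ℕP.*-monoˡ-≤ M β<j) (ℕP.≤-trans (ℕP.m≤m+n _ r) (ℕP.≤-reflexive (sym V≡))))
  ... | r , r< , V≡ | tri> _ _ j<β = inj₁ (ℕP.m≤n⇒m∸n≡0 (ℕP.<⇒≤ V<))
    where
    M = 2 ^ k
    V< : V < β ℕ.* M
    V< = ℕP.<-≤-trans
           (subst (_< suc (half^ k V) ℕ.* M) (sym V≡)
             (ℕP.<-≤-trans (ℕP.+-monoʳ-< (half^ k V ℕ.* M) r<) (ℕP.≤-reflexive (ℕP.+-comm _ M))))
           (ℕP.*-monoˡ-≤ M j<β)

  -- A signed weight w on the grid of the points (x + 1/2, y + 1/2), x, y < 2^m.  Pairings are taken on the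
  -- doubled grid of size N = 2^(m+1), where the point is (2x + 1, 2y + 1) and (u, v) stands for the box
  -- [0, u/2] × [0, v/2].
  module WeightedGrid (m : ℕ) (w : ℕ → ℕ → ℤ) where

    n N : ℕ
    n = 2 ^ m
    N = 2 ^ suc m

    corr : ℕ → ℕ → ℕ → ℤ
    corr K i j = Σℤ n (λ x → Σℤ n (λ y → w x y * (if inCell m K i j x y then + cornerVol4 m K i j x y else + 0)))

    corrSign : ℕ → ℕ → ℕ → ℤ
    corrSign K i j = signum (corr K i j)

    cellMass : ℕ → ℕ
    cellMass K = Σℕ (2 ^ (m ∸ K)) (λ i → Σℕ (2 ^ K) (λ j → ∣ corr K i j ∣))

    mass : ℕ
    mass = Σℕ n (λ x → Σℕ n (λ y → ∣ w x y ∣))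

    anchoredDisc : ℕ → ℕ → ℤ
    anchoredDisc u v = Σℤ n (λ x → Σℤ n (λ y → w x y * (𝟙[ 2 ℕ.* x ℕ.+ 1 ≤ u ] * 𝟙[ 2 ℕ.* y ℕ.+ 1 ≤ v ])))

    ⟨D,_⟩ : (ℕ → ℕ → ℤ) → ℤ
    ⟨D, G ⟩ = Σℤ N (λ u → Σℤ N (λ v → anchoredDisc u v * G u v))

    ⟨D,⟩-by-points : ∀ G → ⟨D, G ⟩ ≡
      Σℤ n (λ x → Σℤ n (λ y → w x y * Σℤ N (λ u → Σℤ N (λ v → (𝟙[ 2 ℕ.* x ℕ.+ 1 ≤ u ] * 𝟙[ 2 ℕ.* y ℕ.+ 1 ≤ v ]) * G u v))))
    ⟨D,⟩-by-points G = sym (begin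
        Σℤ n (λ x → Σℤ n (λ y → w x y * Σℤ N (λ u → Σℤ N (λ v → H x y u v))))
          ≡⟨ Σℤ-cong n (λ x _ → Σℤ-cong n (λ y _ → sym (trans (Σℤ-cong N (λ u _ → Σℤ-*ˡ N (w x y) _)) (Σℤ-*ˡ N (w x y) _)))) ⟩
        Σℤ n (λ x → Σℤ n (λ y → Σℤ N (λ u → Σℤ N (λ v → w x y * H x y u v))))
          ≡⟨ Σℤ²-swap n n N N (λ x y u v → w x y * H x y u v) ⟩
        Σℤ N (λ u → Σℤ N (λ v → Σℤ n (λ x → Σℤ n (λ y → w x y * H x y u v))))
          ≡⟨ Σℤ-cong N (λ u _ → Σℤ-cong N (λ v _ → pull u v)) ⟩
        ⟨D, G ⟩ ∎)
      where
      open ≡-Reasoning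
      H = λ x y u v → (𝟙[ 2 ℕ.* x ℕ.+ 1 ≤ u ] * 𝟙[ 2 ℕ.* y ℕ.+ 1 ≤ v ]) * G u v
      pull : ∀ u v → Σℤ n (λ x → Σℤ n (λ y → w x y * H x y u v)) ≡ anchoredDisc u v * G u v
      pull u v = trans (Σℤ-cong n (λ x _ → Σℤ-cong n (λ y _ → sym (ℤP.*-assoc (w x y) _ (G u v)))))
                   (trans (Σℤ-cong n (λ x _ → Σℤ-*ʳ n (G u v) _)) (Σℤ-*ʳ n (G u v) _))

    ⟨D,⟩-cong : ∀ {G H} → (∀ u v → G u v ≡ H u v) → ⟨D, G ⟩ ≡ ⟨D, H ⟩
    ⟨D,⟩-cong e = Σℤ-cong N (λ u _ → Σℤ-cong N (λ v _ → cong (anchoredDisc u v *_) (e u v)))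

    ⟨D,⟩-linear : ∀ a G H → ⟨D, (λ u v → a * G u v + H u v) ⟩ ≡ a * ⟨D, G ⟩ + ⟨D, H ⟩
    ⟨D,⟩-linear a G H = begin
        Σℤ N (λ u → Σℤ N (λ v → anchoredDisc u v * (a * G u v + H u v)))
          ≡⟨ Σℤ-cong N (λ u _ → Σℤ-cong N (λ v _ → distrib (anchoredDisc u v) a (G u v) (H u v))) ⟩
        Σℤ N (λ u → Σℤ N (λ v → a * (anchoredDisc u v * G u v) + anchoredDisc u v * H u v))
          ≡⟨ trans (Σℤ-cong N (λ u _ → Σℤ-+ N _ _)) (Σℤ-+ N _ _) ⟩
        Σℤ N (λ u → Σℤ N (λ v → a * (anchoredDisc u v * G u v))) + ⟨D, H ⟩
          ≡⟨ cong (_+ ⟨D, H ⟩) (trans (Σℤ-cong N (λ u _ → Σℤ-*ˡ N a _)) (Σℤ-*ˡ N a _)) ⟩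
        a * ⟨D, G ⟩ + ⟨D, H ⟩ ∎
      where
      open ≡-Reasoning
      distrib : ∀ d a g h → d * (a * g + h) ≡ a * (d * g) + d * h
      distrib = ℤ-Solver.solve-∀

  module Riesz₂ (m L' : ℕ) (w : ℕ → ℕ → ℤ) where

    open WeightedGrid m w public

    L : ℕ
    L = suc L'

    -- The sign of level k, x-block β on the row v: the product Haar function of the cell of level k
    -- containing (β, v), weighted by the sign of its correlation, is ySign v k β · −1^ (half^ k u).
    ySign : ℕ → ℕ → ℕ → ℤ
    ySign v k β = corrSign k β (half^ (suc (m ∸ k)) v) * −1^ (half^ (m ∸ k) v)

    ySign-isSign : ∀ v k β → IsSign (ySign v k β)
    ySign-isSign v k β = IsSign-* (signum-isSign (corr k β (half^ (suc (m ∸ k)) v))) (−1^-isSign (half^ (m ∸ k) v))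

    module Row (v : ℕ) = Riesz₁ L' (ySign v) (ySign-isSign v)

    riesz₂ : ℕ → ℕ → ℕ → ℤ
    riesz₂ K u v = Row.riesz v K u

    haar : ℕ → ℕ → ℕ → ℤ
    haar K u v = ySign v K (half^ (suc K) u) * −1^ (half^ K u)

    riesz₂-local : ∀ K d u v v′ → K ℕ.+ d ≡ m → half^ (suc d) v ≡ half^ (suc d) v′ → riesz₂ K u v ≡ riesz₂ K u v′
    riesz₂-local zero d u v v′ _ _ = refl
    riesz₂-local (suc K) d u v v′ K+d≡m same =
      cong₂ _*_ (riesz₂-local K (suc d) u v v′ K+1+d≡m (cong ⌊_/2⌋ same))
                (cong (λ z → + L + z * −1^ (half^ K u)) (ySign-local (half^ (suc K) u)))
      where
      K+1+d≡m : K ℕ.+ suc d ≡ m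
      K+1+d≡m = trans (ℕP.+-suc K d) K+d≡m
      ySign-local : ∀ β → ySign v K β ≡ ySign v′ K β
      ySign-local β rewrite sym K+1+d≡m | ℕP.m+n∸m≡n K (suc d) | same = refl

    N≡ : ∀ a b → a ℕ.+ b ≡ m → N ≡ 2 ^ a ℕ.* 2 ^ suc b
    N≡ a b a+b≡m = trans (cong (λ z → 2 ^ suc z) (sym a+b≡m))
                     (trans (cong (2 ^_) (sym (ℕP.+-suc a b))) (ℕP.^-distribˡ-+-* 2 a (suc b)))

    Σv-haar : ∀ K → K ≤ m → ∀ u V → V < N →
      Σℤ N (λ v → 𝟙[ V ≤ v ] * (riesz₂ K u v * haar K u v)) ≡
        (riesz₂ K u V * (corrSign K (half^ (suc K) u) (half^ (suc (m ∸ K)) V) * −1^ (half^ K u)))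
          * (- + tent (2 ^ suc (m ∸ K)) (V ∸ half^ (suc (m ∸ K)) V ℕ.* 2 ^ suc (m ∸ K)))
    Σv-haar K K≤m u V V<N = begin
        Σℤ N g
          ≡⟨ cong (λ z → Σℤ z g) (N≡ K a K+a≡m) ⟩
        Σℤ (2 ^ K ℕ.* M) g
          ≡⟨ Σℤ-one-block (2 ^ K) M g Q j j< block others ⟩
        Q j
          ≡⟨ cong (λ z → (z * (corrSign K i j * −1^ (half^ K u))) * (- + tent M (V ∸ j ℕ.* M)))
                  (riesz₂-local K a u (j ℕ.* M) V K+a≡m (half^-*2^ (suc a) j)) ⟩
        (riesz₂ K u V * (corrSign K i j * −1^ (half^ K u))) * (- + tent M (V ∸ j ℕ.* M)) ∎
      where
      open ≡-Reasoning
      a = m ∸ K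
      K+a≡m = ℕP.m+[n∸m]≡n K≤m
      M = 2 ^ suc a
      i = half^ (suc K) u
      j = half^ (suc a) V
      g = λ v → 𝟙[ V ≤ v ] * (riesz₂ K u v * haar K u v)
      C = λ β → riesz₂ K u (β ℕ.* M) * (corrSign K i β * −1^ (half^ K u))
      Q = λ β → C β * (- + tent M (V ∸ β ℕ.* M))
      j< : j < 2 ^ K
      j< = half^-< (suc a) V (2 ^ K) (subst (V <_) (N≡ K a K+a≡m) V<N)
      regroup : ∀ i r e s₁ s₂ → i * (r * ((e * s₁) * s₂)) ≡ (r * (e * s₂)) * (i * s₁)
      regroup = ℤ-Solver.solve-∀
      term : ∀ β t → t < M → g (β ℕ.* M ℕ.+ t) ≡ C β * (𝟙[ V ∸ β ℕ.* M ≤ t ] * −1^ (half^ a t))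
      term β t t<M
        rewrite 𝟙-shift (β ℕ.* M) V t | half^-block (suc a) β t t<M | −1^-periodic a β t
              | riesz₂-local K a u (β ℕ.* M ℕ.+ t) (β ℕ.* M) K+a≡m (trans (half^-block (suc a) β t t<M) (sym (half^-*2^ (suc a) β)))
              = regroup 𝟙[ V ∸ β ℕ.* M ≤ t ] (riesz₂ K u (β ℕ.* M)) (corrSign K i β) (−1^ (half^ a t)) (−1^ (half^ K u))
      block : ∀ β → Σℤ M (λ t → g (β ℕ.* M ℕ.+ t)) ≡ Q β
      block β = trans (Σℤ-cong M (term β)) (trans (Σℤ-*ˡ M (C β) _) (cong (C β *_) (Σ𝟙-haar a (V ∸ β ℕ.* M))))
      others : ∀ β → β < 2 ^ K → β ≢ j → Q β ≡ + 0
      others β _ β≢ = trans (cong (λ z → C β * - + z) (tent-outside M _ (offset-outside (suc a) V β β≢))) (ℤP.*-zeroʳ (C β))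

    haarSum-outside : ∀ V K α w′ → (w′ ≡ 0) ⊎ (2 ^ suc K ≤ w′) → Row.haarSum V K α w′ ≡ + 0
    haarSum-outside V K α .0 (inj₁ refl) = Row.haarSum-full V K α
    haarSum-outside V K α w′ (inj₂ le) = Row.haarSum-empty V K α w′ le

    Σu-haar : ∀ K → K ≤ m → ∀ U V j → U < N →
      Σℤ N (λ u → 𝟙[ U ≤ u ] * (riesz₂ K u V * (corrSign K (half^ (suc K) u) j * −1^ (half^ K u)))) ≡
        corrSign K (half^ (suc K) U) j * Row.haarSum V K (half^ (suc K) U) (U ∸ half^ (suc K) U ℕ.* 2 ^ suc K)
    Σu-haar K K≤m U V j U<N = begin
        Σℤ N g                 ≡⟨ cong (λ z → Σℤ z g) (N≡ a K a+K≡m) ⟩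
        Σℤ (2 ^ a ℕ.* M) g     ≡⟨ Σℤ-one-block (2 ^ a) M g Q i i< block others ⟩
        Q i ∎
      where
      open ≡-Reasoning
      a = m ∸ K
      a+K≡m = ℕP.m∸n+n≡m K≤m
      M = 2 ^ suc K
      i = half^ (suc K) U
      g = λ u → 𝟙[ U ≤ u ] * (riesz₂ K u V * (corrSign K (half^ (suc K) u) j * −1^ (half^ K u)))
      Q = λ α → corrSign K α j * Row.haarSum V K α (U ∸ α ℕ.* M)
      i< : i < 2 ^ a
      i< = half^-< (suc K) U (2 ^ a) (subst (U <_) (N≡ a K a+K≡m) U<N)
      regroup : ∀ i r e s → i * (r * (e * s)) ≡ e * (i * (r * s))
      regroup = ℤ-Solver.solve-∀
      term : ∀ α t → t < M → g (α ℕ.* M ℕ.+ t) ≡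
        corrSign K α j * (𝟙[ U ∸ α ℕ.* M ≤ t ] * (riesz₂ K (α ℕ.* M ℕ.+ t) V * −1^ (half^ K (α ℕ.* M ℕ.+ t))))
      term α t t<M rewrite 𝟙-shift (α ℕ.* M) U t | half^-block (suc K) α t t<M =
        regroup 𝟙[ U ∸ α ℕ.* M ≤ t ] (riesz₂ K (α ℕ.* M ℕ.+ t) V) (corrSign K α j) (−1^ (half^ K (α ℕ.* M ℕ.+ t)))
      block : ∀ α → Σℤ M (λ t → g (α ℕ.* M ℕ.+ t)) ≡ Q α
      block α = trans (Σℤ-cong M (term α)) (Σℤ-*ˡ M (corrSign K α j) _)
      others : ∀ α → α < 2 ^ a → α ≢ i → Q α ≡ + 0
      others α _ α≢ = trans (cong (corrSign K α j *_) (haarSum-outside V K α _ (offset-outside (suc K) U α α≢)))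
                            (ℤP.*-zeroʳ (corrSign K α j))

    Σuv-haar : ∀ K → K ≤ m → ∀ U V → U < N → V < N →
      Σℤ N (λ u → Σℤ N (λ v → (𝟙[ U ≤ u ] * 𝟙[ V ≤ v ]) * (riesz₂ K u v * haar K u v))) ≡
        (corrSign K (half^ (suc K) U) (half^ (suc (m ∸ K)) V) * Row.haarSum V K (half^ (suc K) U) (U ∸ half^ (suc K) U ℕ.* 2 ^ suc K))
          * (- + tent (2 ^ suc (m ∸ K)) (V ∸ half^ (suc (m ∸ K)) V ℕ.* 2 ^ suc (m ∸ K)))
    Σuv-haar K K≤m U V U<N V<N = begin
        Σℤ N (λ u → Σℤ N (λ v → (𝟙[ U ≤ u ] * 𝟙[ V ≤ v ]) * G u v))
          ≡⟨ Σℤ-cong N (λ u _ → trans (Σℤ-cong N (λ v _ → ℤP.*-assoc 𝟙[ U ≤ u ] 𝟙[ V ≤ v ] (G u v)))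
                                      (Σℤ-*ˡ N 𝟙[ U ≤ u ] (λ v → 𝟙[ V ≤ v ] * G u v))) ⟩
        Σℤ N (λ u → 𝟙[ U ≤ u ] * Σℤ N (λ v → 𝟙[ V ≤ v ] * G u v))
          ≡⟨ Σℤ-cong N (λ u _ → trans (cong (𝟙[ U ≤ u ] *_) (Σv-haar K K≤m u V V<N)) (sym (ℤP.*-assoc 𝟙[ U ≤ u ] (X u) Y))) ⟩
        Σℤ N (λ u → 𝟙[ U ≤ u ] * X u * Y)
          ≡⟨ Σℤ-*ʳ N Y (λ u → 𝟙[ U ≤ u ] * X u) ⟩
        Σℤ N (λ u → 𝟙[ U ≤ u ] * X u) * Y
          ≡⟨ cong (_* Y) (Σu-haar K K≤m U V j U<N) ⟩
        (corrSign K (half^ (suc K) U) j * Row.haarSum V K (half^ (suc K) U) (U ∸ half^ (suc K) U ℕ.* 2 ^ suc K)) * Y ∎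
      where
      open ≡-Reasoning
      j = half^ (suc (m ∸ K)) V
      G = λ u v → riesz₂ K u v * haar K u v
      X = λ u → riesz₂ K u V * (corrSign K (half^ (suc K) u) j * −1^ (half^ K u))
      Y = - + tent (2 ^ suc (m ∸ K)) (V ∸ j ℕ.* 2 ^ suc (m ∸ K))

    xOffset yOffset xTent yTent : ℕ → ℕ → ℕ
    xOffset K x = 2 ℕ.* x ℕ.+ 1 ∸ half^ K x ℕ.* 2 ^ suc K
    yOffset K y = 2 ℕ.* y ℕ.+ 1 ∸ half^ (m ∸ K) y ℕ.* 2 ^ suc (m ∸ K)
    xTent K x = tent (2 ^ suc K) (xOffset K x)
    yTent K y = tent (2 ^ suc (m ∸ K)) (yOffset K y)

    pointSign pointHaar pointDefect : ℕ → ℕ → ℕ → ℤ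
    pointSign K x y = corrSign K (half^ K x) (half^ (m ∸ K) y)
    pointHaar K x y = Row.haarSum (2 ℕ.* y ℕ.+ 1) K (half^ K x) (xOffset K x)
    pointDefect K x y = (pointSign K x y * (pointHaar K x y + + (L ^ K ℕ.* xTent K x))) * + yTent K y

    pointDefect-bound : ∀ K → K ≤ m → ∀ x y → L' ℕ.* ∣ pointDefect K x y ∣ ≤ (2 ℕ.* n) ℕ.* L ^ K
    pointDefect-bound K K≤m x y = begin
        L' ℕ.* ∣ pointDefect K x y ∣
          ≡⟨ cong (L' ℕ.*_) (trans (ℤP.abs-* (pointSign K x y * τ) (+ yTent K y))
                               (cong (ℕ._* yTent K y) (IsSign⇒∣*∣ (signum-isSign (corr K (half^ K x) (half^ (m ∸ K) y))) τ))) ⟩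
        L' ℕ.* (∣ τ ∣ ℕ.* yTent K y)
          ≡⟨ sym (ℕP.*-assoc L' ∣ τ ∣ (yTent K y)) ⟩
        (L' ℕ.* ∣ τ ∣) ℕ.* yTent K y
          ≤⟨ ℕP.*-mono-≤ (Row.haarSum≈tent (2 ℕ.* y ℕ.+ 1) K (half^ K x) (xOffset K x)) (tent-≤ (m ∸ K) (yOffset K y)) ⟩
        (2 ^ suc K ℕ.* L ^ K) ℕ.* 2 ^ (m ∸ K)
          ≡⟨ regroup (2 ^ K) (L ^ K) (2 ^ (m ∸ K)) ⟩
        (2 ℕ.* (2 ^ K ℕ.* 2 ^ (m ∸ K))) ℕ.* L ^ K
          ≡⟨ cong (λ z → (2 ℕ.* z) ℕ.* L ^ K) (trans (sym (ℕP.^-distribˡ-+-* 2 K (m ∸ K))) (cong (2 ^_) (ℕP.m+[n∸m]≡n K≤m))) ⟩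
        (2 ℕ.* n) ℕ.* L ^ K ∎
      where
      open ℕP.≤-Reasoning
      τ = pointHaar K x y + + (L ^ K ℕ.* xTent K x)
      regroup : ∀ p l q → ((2 ℕ.* p) ℕ.* l) ℕ.* q ≡ (2 ℕ.* (p ℕ.* q)) ℕ.* l
      regroup = ℕ-Solver.solve-∀

    odd< : ∀ x → x < n → 2 ℕ.* x ℕ.+ 1 < N
    odd< x x< = ℕP.≤-trans (ℕP.≤-reflexive (shape x)) (ℕP.*-monoʳ-≤ 2 x<)
      where
      shape : ∀ x → suc (2 ℕ.* x ℕ.+ 1) ≡ 2 ℕ.* suc x
      shape = ℕ-Solver.solve-∀

    Σuv-haar-point : ∀ K → K ≤ m → ∀ x y → x < n → y < n →
      Σℤ N (λ u → Σℤ N (λ v → (𝟙[ 2 ℕ.* x ℕ.+ 1 ≤ u ] * 𝟙[ 2 ℕ.* y ℕ.+ 1 ≤ v ]) * (riesz₂ K u v * haar K u v))) ≡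
        + (L ^ K) * (pointSign K x y * + cornerVol4 m K (half^ K x) (half^ (m ∸ K) y) x y) - pointDefect K x y
    Σuv-haar-point K K≤m x y x< y< = begin
        _ ≡⟨ Σuv-haar K K≤m (2 ℕ.* x ℕ.+ 1) (2 ℕ.* y ℕ.+ 1) (odd< x x<) (odd< y y<) ⟩
        _ ≡⟨ cong₂ (λ i j → (corrSign K i j * Row.haarSum (2 ℕ.* y ℕ.+ 1) K i (2 ℕ.* x ℕ.+ 1 ∸ i ℕ.* 2 ^ suc K))
                              * (- + tent (2 ^ suc (m ∸ K)) (2 ℕ.* y ℕ.+ 1 ∸ j ℕ.* 2 ^ suc (m ∸ K))))
                   (half^-odd K x) (half^-odd (m ∸ K) y) ⟩
        (e * t) * (- b)
          ≡⟨ rearrange e t a b ⟩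
        e * (a * b) - pointDefect K x y
          ≡⟨ cong (λ z → e * z - pointDefect K x y) (trans (sym (ℤP.pos-* (L ^ K ℕ.* xTent K x) (yTent K y)))
                (trans (cong +_ (ℕP.*-assoc (L ^ K) (xTent K x) (yTent K y))) (ℤP.pos-* (L ^ K) _))) ⟩
        e * (+ (L ^ K) * + (xTent K x ℕ.* yTent K y)) - pointDefect K x y
          ≡⟨ cong (_- pointDefect K x y) (swap e (+ (L ^ K)) _) ⟩
        + (L ^ K) * (e * + (xTent K x ℕ.* yTent K y)) - pointDefect K x y
          ≡⟨ cong (λ z → + (L ^ K) * (e * + z) - pointDefect K x y) (sym (cornerVol4≡tent*tent m K x y)) ⟩
        + (L ^ K) * (e * + cornerVol4 m K (half^ K x) (half^ (m ∸ K) y) x y) - pointDefect K x y ∎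
      where
      open ≡-Reasoning
      e = pointSign K x y
      t = pointHaar K x y
      a = + (L ^ K ℕ.* xTent K x)
      b = + yTent K y
      rearrange : ∀ e t a b → (e * t) * (- b) ≡ e * (a * b) - (e * (t + a)) * b
      rearrange = ℤ-Solver.solve-∀
      swap : ∀ e l c → e * (l * c) ≡ l * (e * c)
      swap = ℤ-Solver.solve-∀

    Σ-signed-cornerVol : ∀ K → K ≤ m →
      Σℤ n (λ x → Σℤ n (λ y → w x y * (pointSign K x y * + cornerVol4 m K (half^ K x) (half^ (m ∸ K) y) x y))) ≡ + cellMass K
    Σ-signed-cornerVol K K≤m = begin
        Σℤ n (λ x → Σℤ n (λ y → F (half^ K x) (half^ (m ∸ K) y) x y))
          ≡⟨ Σ-by-cells m K K≤m F ⟩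
        Σℤ A (λ i → Σℤ B (λ j → Σℤ n (λ x → Σℤ n (λ y → if inCell m K i j x y then F i j x y else + 0))))
          ≡⟨ Σℤ-cong A (λ i _ → Σℤ-cong B (λ j _ → cell i j)) ⟩
        Σℤ A (λ i → Σℤ B (λ j → + ∣ corr K i j ∣))
          ≡⟨ trans (Σℤ-cong A (λ i _ → Σℤ-pos B (λ j → ∣ corr K i j ∣))) (Σℤ-pos A _) ⟩
        + cellMass K ∎
      where
      open ≡-Reasoning
      A = 2 ^ (m ∸ K)
      B = 2 ^ K
      F = λ i j x y → w x y * (corrSign K i j * + cornerVol4 m K i j x y)
      factor : ∀ b i j x y → (if b then F i j x y else + 0) ≡ corrSign K i j * (w x y * (if b then + cornerVol4 m K i j x y else + 0))
      factor true i j x y = swap (w x y) (corrSign K i j) (+ cornerVol4 m K i j x y)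
        where
        swap : ∀ a e v → a * (e * v) ≡ e * (a * v)
        swap = ℤ-Solver.solve-∀
      factor false i j x y = sym (trans (cong (corrSign K i j *_) (ℤP.*-zeroʳ (w x y))) (ℤP.*-zeroʳ (corrSign K i j)))
      cell : ∀ i j → Σℤ n (λ x → Σℤ n (λ y → if inCell m K i j x y then F i j x y else + 0)) ≡ + ∣ corr K i j ∣
      cell i j = trans (Σℤ-cong n (λ x _ → Σℤ-cong n (λ y _ → factor (inCell m K i j x y) i j x y)))
                   (trans (trans (Σℤ-cong n (λ x _ → Σℤ-*ˡ n (corrSign K i j) _)) (Σℤ-*ˡ n (corrSign K i j) _))
                          (signum-* (corr K i j)))

    ⟨D,haar⟩ : ∀ K → K ≤ m → ∃ λ Err →
      (⟨D, (λ u v → riesz₂ K u v * haar K u v) ⟩ ≡ + (L ^ K) * + cellMass K - Err) ×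
      (L' ℕ.* ∣ Err ∣ ≤ mass ℕ.* ((2 ℕ.* n) ℕ.* L ^ K))
    ⟨D,haar⟩ K K≤m = Err , pairing , Σℤ²-weighted-bound n n w (pointDefect K) L' _ (pointDefect-bound K K≤m)
      where
      Main = λ x y → w x y * (pointSign K x y * + cornerVol4 m K (half^ K x) (half^ (m ∸ K) y) x y)
      Err = Σℤ n (λ x → Σℤ n (λ y → w x y * pointDefect K x y))
      distrib : ∀ a l p q → a * (l * p - q) ≡ l * (a * p) - a * q
      distrib = ℤ-Solver.solve-∀
      pairing : ⟨D, (λ u v → riesz₂ K u v * haar K u v) ⟩ ≡ + (L ^ K) * + cellMass K - Err
      pairing = begin
          ⟨D, (λ u v → riesz₂ K u v * haar K u v) ⟩
            ≡⟨ ⟨D,⟩-by-points _ ⟩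
          _ ≡⟨ Σℤ-cong n (λ x x< → Σℤ-cong n (λ y y< → cong (w x y *_) (Σuv-haar-point K K≤m x y x< y<))) ⟩
          _ ≡⟨ Σℤ-cong n (λ x _ → Σℤ-cong n (λ y _ → distrib (w x y) (+ (L ^ K)) _ (pointDefect K x y))) ⟩
          Σℤ n (λ x → Σℤ n (λ y → + (L ^ K) * Main x y - w x y * pointDefect K x y))
            ≡⟨ trans (Σℤ-cong n (λ x _ → Σℤ-sub n _ _)) (Σℤ-sub n _ _) ⟩
          Σℤ n (λ x → Σℤ n (λ y → + (L ^ K) * Main x y)) - Err
            ≡⟨ cong (_- Err) (trans (Σℤ-cong n (λ x _ → Σℤ-*ˡ n (+ (L ^ K)) _)) (Σℤ-*ˡ n (+ (L ^ K)) _)) ⟩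
          + (L ^ K) * Σℤ n (λ x → Σℤ n (λ y → Main x y)) - Err
            ≡⟨ cong (λ z → + (L ^ K) * z - Err) (Σ-signed-cornerVol K K≤m) ⟩
          + (L ^ K) * + cellMass K - Err ∎
        where open ≡-Reasoning

    deviation : ℕ → ℕ → ℕ → ℤ
    deviation K u v = riesz₂ K u v - + (L ^ K)

    deviation-step : ∀ K u v → deviation (suc K) u v ≡ + L * deviation K u v + riesz₂ K u v * haar K u v
    deviation-step K u v =
      trans (cong (λ z → riesz₂ K u v * (+ L + haar K u v) - z) (ℤP.pos-* L (L ^ K)))
            (rearrange (riesz₂ K u v) (+ L) (haar K u v) (+ (L ^ K)))
      where
      rearrange : ∀ p l f q → p * (l + f) - l * q ≡ l * (p - q) + p * f
      rearrange = ℤ-Solver.solve-∀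

    error-step : ∀ K F Err → L' ℕ.* ∣ F ∣ ≤ K ℕ.* (mass ℕ.* ((2 ℕ.* n) ℕ.* L ^ K)) →
      L' ℕ.* ∣ Err ∣ ≤ mass ℕ.* ((2 ℕ.* n) ℕ.* L ^ K) →
      L' ℕ.* ∣ + L * F + + L * Err ∣ ≤ suc K ℕ.* (mass ℕ.* ((2 ℕ.* n) ℕ.* L ^ suc K))
    error-step K F Err boundF boundErr = begin
        L' ℕ.* ∣ + L * F + + L * Err ∣
          ≤⟨ ℕP.*-monoʳ-≤ L' (ℕP.≤-trans (ℤP.∣i+j∣≤∣i∣+∣j∣ (+ L * F) (+ L * Err))
                                         (ℕP.≤-reflexive (cong₂ ℕ._+_ (ℤP.abs-* (+ L) F) (ℤP.abs-* (+ L) Err)))) ⟩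
        L' ℕ.* (L ℕ.* ∣ F ∣ ℕ.+ L ℕ.* ∣ Err ∣)
          ≡⟨ distrib L' L ∣ F ∣ ∣ Err ∣ ⟩
        L ℕ.* (L' ℕ.* ∣ F ∣) ℕ.+ L ℕ.* (L' ℕ.* ∣ Err ∣)
          ≤⟨ ℕP.+-mono-≤ (ℕP.*-monoʳ-≤ L boundF) (ℕP.*-monoʳ-≤ L boundErr) ⟩
        L ℕ.* (K ℕ.* X) ℕ.+ L ℕ.* X
          ≡⟨ collect L K X ⟩
        suc K ℕ.* (L ℕ.* X)
          ≡⟨ cong (suc K ℕ.*_) (trans (x∙yz≈y∙xz L mass _) (cong (mass ℕ.*_) (x∙yz≈y∙xz L (2 ℕ.* n) (L ^ K)))) ⟩
        suc K ℕ.* (mass ℕ.* ((2 ℕ.* n) ℕ.* (L ℕ.* L ^ K))) ∎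
      where
      open ℕP.≤-Reasoning
      X = mass ℕ.* ((2 ℕ.* n) ℕ.* L ^ K)
      distrib : ∀ l' l f e → l' ℕ.* (l ℕ.* f ℕ.+ l ℕ.* e) ≡ l ℕ.* (l' ℕ.* f) ℕ.+ l ℕ.* (l' ℕ.* e)
      distrib = ℕ-Solver.solve-∀
      collect : ∀ l k x → l ℕ.* (k ℕ.* x) ℕ.+ l ℕ.* x ≡ suc k ℕ.* (l ℕ.* x)
      collect = ℕ-Solver.solve-∀

    ⟨D,deviation⟩ : ∀ K → K ≤ suc m → ∃ λ F →
      (+ L * ⟨D, deviation K ⟩ ≡ + (L ^ K) * + sumNat K cellMass - F) ×
      (L' ℕ.* ∣ F ∣ ≤ K ℕ.* (mass ℕ.* ((2 ℕ.* n) ℕ.* L ^ K)))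
    ⟨D,deviation⟩ zero _ = + 0 , trans (cong (+ L *_) ⟨D,0⟩) (ℤP.*-zeroʳ (+ L)) , ℕP.≤-reflexive (ℕP.*-zeroʳ L')
      where
      ⟨D,0⟩ : ⟨D, deviation zero ⟩ ≡ + 0
      ⟨D,0⟩ = Σℤ-vanish N _ (λ u _ → Σℤ-vanish N _ (λ v _ → ℤP.*-zeroʳ (anchoredDisc u v)))
    ⟨D,deviation⟩ (suc K) (s≤s K≤m) = + L * F + + L * Err , pairing , error-step K F Err boundF boundErr
      where
      IH = ⟨D,deviation⟩ K (ℕP.m≤n⇒m≤1+n K≤m)
      F = proj₁ IH
      eqF = proj₁ (proj₂ IH)
      boundF = proj₂ (proj₂ IH)
      level = ⟨D,haar⟩ K K≤m
      Err = proj₁ level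
      eqErr = proj₁ (proj₂ level)
      boundErr = proj₂ (proj₂ level)
      S = sumNat K cellMass
      pairing : + L * ⟨D, deviation (suc K) ⟩ ≡ + (L ^ suc K) * + (S ℕ.+ cellMass K) - (+ L * F + + L * Err)
      pairing = begin
          + L * ⟨D, deviation (suc K) ⟩
            ≡⟨ cong (+ L *_) (trans (⟨D,⟩-cong (deviation-step K)) (⟨D,⟩-linear (+ L) (deviation K) _)) ⟩
          + L * (+ L * ⟨D, deviation K ⟩ + ⟨D, (λ u v → riesz₂ K u v * haar K u v) ⟩)
            ≡⟨ cong₂ (λ a b → + L * (a + b)) eqF eqErr ⟩
          + L * (+ (L ^ K) * + S - F + (+ (L ^ K) * + cellMass K - Err))
            ≡⟨ rearrange (+ L) (+ (L ^ K)) (+ S) (+ cellMass K) F Err ⟩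
          (+ L * + (L ^ K)) * (+ S + + cellMass K) - (+ L * F + + L * Err)
            ≡⟨ cong₂ (λ a b → a * b - (+ L * F + + L * Err)) (sym (ℤP.pos-* L (L ^ K))) (sym (ℤP.pos-+ S (cellMass K))) ⟩
          + (L ^ suc K) * + (S ℕ.+ cellMass K) - (+ L * F + + L * Err) ∎
        where
        open ≡-Reasoning
        rearrange : ∀ l q s c f e → l * (q * s - f + (q * c - e)) ≡ (l * q) * (s + c) - (l * f + l * e)
        rearrange = ℤ-Solver.solve-∀
    Σ∣riesz₂∣ : Σℕ N (λ u → Σℕ N (λ v → ∣ riesz₂ (suc m) u v ∣)) ≡ N ℕ.* (N ℕ.* L ^ suc m)
    Σ∣riesz₂∣ = ℤP.+-injective (begin
        + Σℕ N (λ u → Σℕ N (λ v → ∣ riesz₂ (suc m) u v ∣))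
          ≡⟨ sym (trans (Σℤ-cong N (λ u _ → Σℤ-pos N _)) (Σℤ-pos N _)) ⟩
        Σℤ N (λ u → Σℤ N (λ v → + ∣ riesz₂ (suc m) u v ∣))
          ≡⟨ Σℤ-cong N (λ u _ → Σℤ-cong N (λ v _ → nonneg u v)) ⟩
        Σℤ N (λ u → Σℤ N (λ v → riesz₂ (suc m) u v))
          ≡⟨ Σℤ-swap N N (λ u v → riesz₂ (suc m) u v) ⟩
        Σℤ N (λ v → Σℤ N (λ u → riesz₂ (suc m) u v))
          ≡⟨ Σℤ-cong N (λ v _ → row v) ⟩
        Σℤ N (λ v → + (N ℕ.* L ^ suc m))
          ≡⟨ trans (Σℤ-pos N _) (cong +_ (Σℕ-const N _)) ⟩
        + (N ℕ.* (N ℕ.* L ^ suc m)) ∎)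
      where
      open ≡-Reasoning
      nonneg : ∀ u v → + ∣ riesz₂ (suc m) u v ∣ ≡ riesz₂ (suc m) u v
      nonneg u v with Row.riesz-nonneg v (suc m) u
      ... | k , eq = trans (cong (λ z → + ∣ z ∣) eq) (sym eq)
      row : ∀ v → Σℤ N (λ u → riesz₂ (suc m) u v) ≡ + (N ℕ.* L ^ suc m)
      row v = trans (Σℤ-cong N (λ u _ → sym (ℤP.*-identityˡ (riesz₂ (suc m) u v)))) (Row.blockSum-full v (suc m) 0)

    ∣⟨D,deviation⟩∣≤ : ∀ B → (∀ u v → u < N → v < N → ∣ anchoredDisc u v ∣ ≤ B) →
      ∣ ⟨D, deviation (suc m) ⟩ ∣ ≤ B ℕ.* (2 ℕ.* (N ℕ.* (N ℕ.* L ^ suc m)))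
    ∣⟨D,deviation⟩∣≤ B bounded = begin
        ∣ ⟨D, deviation (suc m) ⟩ ∣
          ≤⟨ ℕP.≤-trans (∣Σℤ∣≤Σℕ∣∣ N _) (Σℕ-mono N _ _ (λ u _ → ∣Σℤ∣≤Σℕ∣∣ N _)) ⟩
        Σℕ N (λ u → Σℕ N (λ v → ∣ anchoredDisc u v * deviation (suc m) u v ∣))
          ≤⟨ Σℕ-mono N _ _ (λ u u< → Σℕ-mono N _ _ (λ v v< → pointwise u v u< v<)) ⟩
        Σℕ N (λ u → Σℕ N (λ v → B ℕ.* (∣ riesz₂ (suc m) u v ∣ ℕ.+ Λ)))
          ≡⟨ trans (Σℕ-cong N (λ u _ → Σℕ-*ˡ N B _)) (Σℕ-*ˡ N B _) ⟩
        B ℕ.* Σℕ N (λ u → Σℕ N (λ v → ∣ riesz₂ (suc m) u v ∣ ℕ.+ Λ))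
          ≡⟨ cong (B ℕ.*_) (trans (Σℕ-cong N (λ u _ → Σℕ-+ N _ _)) (Σℕ-+ N _ _)) ⟩
        B ℕ.* (Σℕ N (λ u → Σℕ N (λ v → ∣ riesz₂ (suc m) u v ∣)) ℕ.+ Σℕ N (λ u → Σℕ N (λ v → Λ)))
          ≡⟨ cong₂ (λ a b → B ℕ.* (a ℕ.+ b)) Σ∣riesz₂∣ (trans (Σℕ-cong N (λ u _ → Σℕ-const N Λ)) (Σℕ-const N _)) ⟩
        B ℕ.* (N ℕ.* (N ℕ.* Λ) ℕ.+ N ℕ.* (N ℕ.* Λ))
          ≡⟨ cong (B ℕ.*_) (cong (N ℕ.* (N ℕ.* Λ) ℕ.+_) (sym (ℕP.+-identityʳ _))) ⟩
        B ℕ.* (2 ℕ.* (N ℕ.* (N ℕ.* Λ))) ∎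
      where
      open ℕP.≤-Reasoning
      Λ = L ^ suc m
      pointwise : ∀ u v → u < N → v < N → ∣ anchoredDisc u v * deviation (suc m) u v ∣ ≤ B ℕ.* (∣ riesz₂ (suc m) u v ∣ ℕ.+ Λ)
      pointwise u v u< v< = ℕP.≤-trans (ℕP.≤-reflexive (ℤP.abs-* (anchoredDisc u v) _))
                              (ℕP.*-mono-≤ (bounded u v u< v<) (ℤP.∣i-j∣≤∣i∣+∣j∣ (riesz₂ (suc m) u v) (+ Λ)))

    cellMass-bound : ∀ B → (∀ u v → u < N → v < N → ∣ anchoredDisc u v ∣ ≤ B) →
      L' ℕ.* sumNat (suc m) cellMass ≤ L' ℕ.* (L ℕ.* (B ℕ.* (2 ℕ.* (N ℕ.* N)))) ℕ.+ suc m ℕ.* (mass ℕ.* (2 ℕ.* n))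
    cellMass-bound B bounded = ℕP.*-cancelˡ-≤ Λ {{ℕP.m^n≢0 L (suc m)}} (begin
        Λ ℕ.* (L' ℕ.* S)
          ≡⟨ x∙yz≈y∙xz Λ L' S ⟩
        L' ℕ.* (Λ ℕ.* S)
          ≤⟨ ℕP.*-monoʳ-≤ L' main≤ ⟩
        L' ℕ.* (L ℕ.* ∣ ⟨D, deviation (suc m) ⟩ ∣ ℕ.+ ∣ F ∣)
          ≡⟨ ℕP.*-distribˡ-+ L' _ ∣ F ∣ ⟩
        L' ℕ.* (L ℕ.* ∣ ⟨D, deviation (suc m) ⟩ ∣) ℕ.+ L' ℕ.* ∣ F ∣
          ≤⟨ ℕP.+-mono-≤ (ℕP.*-monoʳ-≤ L' (ℕP.*-monoʳ-≤ L (∣⟨D,deviation⟩∣≤ B bounded))) boundF ⟩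
        L' ℕ.* (L ℕ.* (B ℕ.* (2 ℕ.* (N ℕ.* (N ℕ.* Λ))))) ℕ.+ suc m ℕ.* (mass ℕ.* ((2 ℕ.* n) ℕ.* Λ))
          ≡⟨ cong₂ ℕ._+_ (factor₁ L' L B N Λ) (factor₂ (suc m) mass (2 ℕ.* n) Λ) ⟩
        Λ ℕ.* (L' ℕ.* (L ℕ.* (B ℕ.* (2 ℕ.* (N ℕ.* N))))) ℕ.+ Λ ℕ.* (suc m ℕ.* (mass ℕ.* (2 ℕ.* n)))
          ≡⟨ sym (ℕP.*-distribˡ-+ Λ _ _) ⟩
        Λ ℕ.* (L' ℕ.* (L ℕ.* (B ℕ.* (2 ℕ.* (N ℕ.* N)))) ℕ.+ suc m ℕ.* (mass ℕ.* (2 ℕ.* n))) ∎)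
      where
      open ℕP.≤-Reasoning
      Λ = L ^ suc m
      S = sumNat (suc m) cellMass
      total = ⟨D,deviation⟩ (suc m) ℕP.≤-refl
      F = proj₁ total
      eqF = proj₁ (proj₂ total)
      boundF = proj₂ (proj₂ total)
      main≤ : Λ ℕ.* S ≤ L ℕ.* ∣ ⟨D, deviation (suc m) ⟩ ∣ ℕ.+ ∣ F ∣
      main≤ = begin
          Λ ℕ.* S                                    ≡⟨ sym (ℤP.abs-* (+ Λ) (+ S)) ⟩
          ∣ + Λ * + S ∣                               ≡⟨ cong ∣_∣ (trans (solve (+ Λ * + S) F) (cong (_+ F) (sym eqF))) ⟩
          ∣ + L * ⟨D, deviation (suc m) ⟩ + F ∣        ≤⟨ ℤP.∣i+j∣≤∣i∣+∣j∣ (+ L * ⟨D, deviation (suc m) ⟩) F ⟩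
          ∣ + L * ⟨D, deviation (suc m) ⟩ ∣ ℕ.+ ∣ F ∣  ≡⟨ cong (ℕ._+ ∣ F ∣) (ℤP.abs-* (+ L) ⟨D, deviation (suc m) ⟩) ⟩
          L ℕ.* ∣ ⟨D, deviation (suc m) ⟩ ∣ ℕ.+ ∣ F ∣ ∎
        where
        solve : ∀ a f → a ≡ (a - f) + f
        solve = ℤ-Solver.solve-∀
      factor₁ : ∀ l' l b N q → l' ℕ.* (l ℕ.* (b ℕ.* (2 ℕ.* (N ℕ.* (N ℕ.* q))))) ≡ q ℕ.* (l' ℕ.* (l ℕ.* (b ℕ.* (2 ℕ.* (N ℕ.* N)))))
      factor₁ = ℕ-Solver.solve-∀
      factor₂ : ∀ k a t q → k ℕ.* (a ℕ.* (t ℕ.* q)) ≡ q ℕ.* (k ℕ.* (a ℕ.* t))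
      factor₂ = ℕ-Solver.solve-∀

  argmax : ∀ N (f : ℕ → ℕ) → ∃ λ t* → ∀ t → t < N → f t ≤ f t*
  argmax zero f = 0 , λ _ ()
  argmax (suc N) f with argmax N f
  ... | t* , below with ℕP.≤-total (f N) (f t*)
  ...   | inj₁ fN≤ = t* , λ t t< → Sum.[ below t , (λ t≡N → subst (λ s → f s ≤ f t*) (sym t≡N) fN≤) ] (ℕP.m<1+n⇒m<n∨m≡n t<)
  ...   | inj₂ ≤fN = N , λ t t< → Sum.[ (λ t<N → ℕP.≤-trans (below t t<N) ≤fN) , (λ t≡N → ℕP.≤-reflexive (cong f t≡N)) ] (ℕP.m<1+n⇒m<n∨m≡n t<)

  argmax² : ∀ N (f : ℕ → ℕ → ℕ) → ∃₂ λ u* v* → ∀ u v → u < N → v < N → f u v ≤ f u* v*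
  argmax² N f = u* , best u* , λ u v u< v< → ℕP.≤-trans (proj₂ (argmax N (f u)) v v<) (proj₂ (argmax N (λ u → f u (best u))) u u<)
    where
    best : ℕ → ℕ
    best u = proj₁ (argmax N (f u))
    u* : ℕ
    u* = proj₁ (argmax N (λ u → f u (best u)))

  m≤[1+K]B : ∀ q m n B Δ S M → 1 ≤ m → 1 ≤ n ℕ.* n →
    n ℕ.* n ℕ.* m ℕ.* 4 ≤ q ℕ.* Δ → Δ ≤ S →
    4 ℕ.* q ℕ.* S ≤ 4 ℕ.* q ℕ.* (suc (4 ℕ.* q) ℕ.* (B ℕ.* (2 ℕ.* ((2 ℕ.* n) ℕ.* (2 ℕ.* n))))) ℕ.+ suc m ℕ.* (M ℕ.* (2 ℕ.* n)) →
    M ≤ 2 ℕ.* n →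
    m ≤ suc (4 ℕ.* q ℕ.* suc (4 ℕ.* q)) ℕ.* B
  m≤[1+K]B q m n B Δ S M m≥1 a≥1 separated Δ≤S riesz M≤2n =
    ℕP.≤-trans (ℕP.*-cancelˡ-≤ (8 ℕ.* a) {{ℕ.>-nonZero (ℕP.≤-trans (s≤s z≤n) (ℕP.*-monoʳ-≤ 8 a≥1))}} 8am≤) (ℕP.m≤n+m _ B)
    where
    open ℕP.≤-Reasoning
    a = n ℕ.* n
    K = 4 ℕ.* q ℕ.* suc (4 ℕ.* q)
    X = 4 ℕ.* q ℕ.* (suc (4 ℕ.* q) ℕ.* (B ℕ.* (2 ℕ.* ((2 ℕ.* n) ℕ.* (2 ℕ.* n)))))
    16am≤ : 8 ℕ.* (a ℕ.* m) ℕ.+ 8 ℕ.* (a ℕ.* m) ≤ X ℕ.+ 8 ℕ.* (a ℕ.* m)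
    16am≤ = begin
        8 ℕ.* (a ℕ.* m) ℕ.+ 8 ℕ.* (a ℕ.* m) ≡⟨ e₁ a m ⟩
        4 ℕ.* (a ℕ.* m ℕ.* 4)               ≤⟨ ℕP.*-monoʳ-≤ 4 separated ⟩
        4 ℕ.* (q ℕ.* Δ)                      ≤⟨ ℕP.≤-reflexive (sym (ℕP.*-assoc 4 q Δ)) ⟩
        4 ℕ.* q ℕ.* Δ                        ≤⟨ ℕP.*-monoʳ-≤ (4 ℕ.* q) Δ≤S ⟩
        4 ℕ.* q ℕ.* S                        ≤⟨ riesz ⟩
        X ℕ.+ suc m ℕ.* (M ℕ.* (2 ℕ.* n))    ≤⟨ ℕP.+-monoʳ-≤ X (ℕP.*-mono-≤ (ℕP.+-monoˡ-≤ m m≥1) (ℕP.*-monoˡ-≤ (2 ℕ.* n) M≤2n)) ⟩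
        X ℕ.+ (m ℕ.+ m) ℕ.* (2 ℕ.* n ℕ.* (2 ℕ.* n)) ≡⟨ cong (X ℕ.+_) (e₂ m n) ⟩
        X ℕ.+ 8 ℕ.* (a ℕ.* m) ∎
      where
      e₁ : ∀ a m → 8 ℕ.* (a ℕ.* m) ℕ.+ 8 ℕ.* (a ℕ.* m) ≡ 4 ℕ.* (a ℕ.* m ℕ.* 4)
      e₁ = ℕ-Solver.solve-∀
      e₂ : ∀ m n → (m ℕ.+ m) ℕ.* (2 ℕ.* n ℕ.* (2 ℕ.* n)) ≡ 8 ℕ.* (n ℕ.* n ℕ.* m)
      e₂ = ℕ-Solver.solve-∀
    8am≤ : (8 ℕ.* a) ℕ.* m ≤ (8 ℕ.* a) ℕ.* (K ℕ.* B)
    8am≤ = begin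
      (8 ℕ.* a) ℕ.* m   ≡⟨ ℕP.*-assoc 8 a m ⟩
      8 ℕ.* (a ℕ.* m)   ≤⟨ ℕP.+-cancelʳ-≤ (8 ℕ.* (a ℕ.* m)) _ _ 16am≤ ⟩
      X                 ≡⟨ e₃ q B n ⟩
      (8 ℕ.* (n ℕ.* n)) ℕ.* (K ℕ.* B) ∎
      where
      e₃ : ∀ q B n → 4 ℕ.* q ℕ.* ((1 ℕ.+ 4 ℕ.* q) ℕ.* (B ℕ.* (2 ℕ.* ((2 ℕ.* n) ℕ.* (2 ℕ.* n)))))
                     ≡ (8 ℕ.* (n ℕ.* n)) ℕ.* (4 ℕ.* q ℕ.* (1 ℕ.+ 4 ℕ.* q) ℕ.* B)
      e₃ = ℕ-Solver.solve-∀

  -- Rational arithmetic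

  toℚᵘ-/ : ∀ a k → toℚᵘ ((+ a) ℚ./ suc k) ≃ᵘ mkℚᵘ (+ a) k
  toℚᵘ-/ a k = ℚP.toℚᵘ-fromℚᵘ (mkℚᵘ (+ a) k)

  ≤-fromᵘ : ∀ {p q p′ q′} → toℚᵘ p ≃ᵘ p′ → toℚᵘ q ≃ᵘ q′ → p′ ≤ᵘ q′ → p ℚ.≤ q
  ≤-fromᵘ ep eq le = ℚP.toℚᵘ-cancel-≤ (ℚᵘP.≤-respˡ-≃ (ℚᵘP.≃-sym ep) (ℚᵘP.≤-respʳ-≃ (ℚᵘP.≃-sym eq) le))

  ≤-toᵘ : ∀ {p q p′ q′} → toℚᵘ p ≃ᵘ p′ → toℚᵘ q ≃ᵘ q′ → p ℚ.≤ q → p′ ≤ᵘ q′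
  ≤-toᵘ ep eq le = ℚᵘP.≤-respˡ-≃ ep (ℚᵘP.≤-respʳ-≃ eq (ℚP.toℚᵘ-mono-≤ le))

  T-ext : ∀ {x y : Bool} → (T x → T y) → (T y → T x) → x ≡ y
  T-ext {false} {false} f g = refl
  T-ext {false} {true} f g = ⊥-elim (g tt)
  T-ext {true} {false} f g = ⊥-elim (f tt)
  T-ext {true} {true} f g = refl

  half≤ᵇhalf : ∀ a b → ((+ a) ℚ./ 2 ℚ.≤ᵇ (+ b) ℚ./ 2) ≡ (a ≤ᵇ b)
  half≤ᵇhalf a b = T-ext to from
    where
    *2 : ∀ a → + a * + 2 ≡ + (a ℕ.* 2)
    *2 a = sym (ℤP.pos-* a 2)
    to : T ((+ a) ℚ./ 2 ℚ.≤ᵇ (+ b) ℚ./ 2) → T (a ≤ᵇ b)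
    to t with ≤-toᵘ (toℚᵘ-/ a 1) (toℚᵘ-/ b 1) (ℚP.≤ᵇ⇒≤ t)
    ... | ℚᵘ.*≤* le = ℕP.≤⇒≤ᵇ (ℕP.*-cancelʳ-≤ a b 2 (ℤP.drop‿+≤+ (subst₂ ℤ._≤_ (*2 a) (*2 b) le)))
    from : T (a ≤ᵇ b) → T ((+ a) ℚ./ 2 ℚ.≤ᵇ (+ b) ℚ./ 2)
    from t = ℚP.≤⇒≤ᵇ (≤-fromᵘ (toℚᵘ-/ a 1) (toℚᵘ-/ b 1)
               (ℚᵘ.*≤* (subst₂ ℤ._≤_ (sym (*2 a)) (sym (*2 b)) (ℤ.+≤+ (ℕP.*-monoˡ-≤ 2 (ℕP.≤ᵇ⇒≤ a b t))))))

  0≤ᵇhalf : ∀ a → (0ℚ ℚ.≤ᵇ (+ a) ℚ./ 2) ≡ true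
  0≤ᵇhalf a = T⇒≡true (ℚP.≤⇒≤ᵇ (≤-fromᵘ {p = 0ℚ} {p′ = toℚᵘ 0ℚ} (ℚᵘP.≃-refl {toℚᵘ 0ℚ}) (toℚᵘ-/ a 1)
                (ℚᵘ.*≤* (subst (+ 0 ℤ.≤_) (sym (ℤP.*-identityʳ (+ a))) (ℤ.+≤+ z≤n)))))

  positive⇒≥1/q : ∀ c → 0ℚ ℚ.< c → ∃ λ d → ∀ A D → c ℚ.* ℕtoℚ A ℚ.≤ (+ D) ℚ./ 4 → A ℕ.* 4 ≤ suc d ℕ.* D
  positive⇒≥1/q (ℚ.mkℚ (+ zero) d _) (ℚ.*<* 0<0) = ⊥-elim (ℤP.<-irrefl refl 0<0)
  positive⇒≥1/q (ℚ.mkℚ ℤ.-[1+ p ] d _) (ℚ.*<* 0<neg) = ⊥-elim (ℤP.<-asym 0<neg ℤ.-<+)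
  positive⇒≥1/q (ℚ.mkℚ (+ suc p) d cop) _ = d , scaled
    where
    c = ℚ.mkℚ (+ suc p) d cop
    scaled : ∀ A D → c ℚ.* ℕtoℚ A ℚ.≤ (+ D) ℚ./ 4 → A ℕ.* 4 ≤ suc d ℕ.* D
    scaled A D c*A≤D/4
      with ≤-toᵘ {p′ = mkℚᵘ (+ suc p) d ℚᵘ.* mkℚᵘ (+ A) 0} {q′ = mkℚᵘ (+ D) 3}
             (ℚᵘP.≃-trans (ℚP.toℚᵘ-homo-* c (ℕtoℚ A)) (ℚᵘP.*-congˡ {mkℚᵘ (+ suc p) d} (toℚᵘ-/ A 0)))
             (toℚᵘ-/ D 3) c*A≤D/4
    ... | ℚᵘ.*≤* le = begin
        A ℕ.* 4                       ≤⟨ ℕP.*-monoˡ-≤ 4 (ℕP.m≤n*m A (suc p)) ⟩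
        suc p ℕ.* A ℕ.* 4             ≤⟨ ℤP.drop‿+≤+ (subst₂ ℤ._≤_ lhs rhs le) ⟩
        D ℕ.* suc (d ℕ.* 1)           ≡⟨ trans (cong (λ z → D ℕ.* suc z) (ℕP.*-identityʳ d)) (ℕP.*-comm D (suc d)) ⟩
        suc d ℕ.* D ∎
      where
      open ℕP.≤-Reasoning
      lhs : (+ suc p * + A) * + 4 ≡ + (suc p ℕ.* A ℕ.* 4)
      lhs = trans (cong (_* + 4) (sym (ℤP.pos-* (suc p) A))) (sym (ℤP.pos-* (suc p ℕ.* A) 4))
      rhs : + D * + suc (d ℕ.* 1) ≡ + (D ℕ.* suc (d ℕ.* 1))
      rhs = sym (ℤP.pos-* D (suc (d ℕ.* 1)))

  0<1/suc : ∀ K → 0ℚ ℚ.< (+ 1) ℚ./ suc K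
  0<1/suc K = ℚP.toℚᵘ-cancel-< (ℚᵘP.<-respʳ-≃ (ℚᵘP.≃-sym (toℚᵘ-/ 1 K)) (ℚᵘ.*<* (ℤ.+<+ (s≤s z≤n))))

  ≤-1/suc : ∀ K M X → M ≤ suc K ℕ.* X → ((+ 1) ℚ./ suc K) ℚ.* ℕtoℚ M ℚ.≤ ℕtoℚ X
  ≤-1/suc K M X M≤ =
    ≤-fromᵘ {p′ = mkℚᵘ (+ 1) K ℚᵘ.* mkℚᵘ (+ M) 0} {q′ = mkℚᵘ (+ X) 0}
      (ℚᵘP.≃-trans (ℚP.toℚᵘ-homo-* ((+ 1) ℚ./ suc K) (ℕtoℚ M)) (ℚᵘP.*-cong (toℚᵘ-/ 1 K) (toℚᵘ-/ M 0)))
      (toℚᵘ-/ X 0)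
      (ℚᵘ.*≤* (subst₂ ℤ._≤_ (sym lhs) (sym rhs) (ℤ.+≤+ (ℕP.≤-trans (ℕP.≤-reflexive (e₁ M)) (ℕP.≤-trans M≤ (ℕP.≤-reflexive (e₂ K X)))))))
    where
    lhs : (+ 1 * + M) * + 1 ≡ + ((1 ℕ.* M) ℕ.* 1)
    lhs = trans (cong (_* + 1) (sym (ℤP.pos-* 1 M))) (sym (ℤP.pos-* (1 ℕ.* M) 1))
    rhs : + X * + suc (K ℕ.* 1) ≡ + (X ℕ.* suc (K ℕ.* 1))
    rhs = sym (ℤP.pos-* X (suc (K ℕ.* 1)))
    e₁ : ∀ M → (1 ℕ.* M) ℕ.* 1 ≡ M
    e₁ = ℕ-Solver.solve-∀
    e₂ : ∀ K X → suc K ℕ.* X ≡ X ℕ.* suc (K ℕ.* 1)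
    e₂ = ℕ-Solver.solve-∀

  -- Binary nets

  extend : ∀ {n} {A : Set} → A → (Fin n → A) → ℕ → A
  extend {zero} d f t = d
  extend {suc n} d f zero = f Fin.zero
  extend {suc n} d f (suc t) = extend d (λ i → f (Fin.suc i)) t

  extend-toℕ : ∀ {n} {A : Set} (d : A) (f : Fin n → A) (i : Fin n) → extend d f (toℕ i) ≡ f i
  extend-toℕ d f Fin.zero = refl
  extend-toℕ d f (Fin.suc i) = extend-toℕ d (λ j → f (Fin.suc j)) i

  extend² : ∀ {n} {A : Set} → A → (Fin n → Fin n → A) → ℕ → ℕ → A
  extend² d P x y = extend d (λ x′ → extend d (P x′) y) x

  extend²-toℕ : ∀ {n} {A : Set} (d : A) (P : Fin n → Fin n → A) (x y : Fin n) → extend² d P (toℕ x) (toℕ y) ≡ P x y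
  extend²-toℕ d P x y = trans (extend-toℕ d (λ x′ → extend d (P x′) (toℕ y)) x) (extend-toℕ d (P x) y)

  sumFin≡Σℕ : ∀ n {f : Fin n → ℕ} {g : ℕ → ℕ} → (∀ i → f i ≡ g (toℕ i)) → sumFin f ≡ Σℕ n g
  sumFin≡Σℕ zero e = refl
  sumFin≡Σℕ (suc n) e = cong₂ ℕ._+_ (e Fin.zero) (sumFin≡Σℕ n (λ i → e (Fin.suc i)))

  sumFinℤ≡Σℤ : ∀ n {f : Fin n → ℤ} {g : ℕ → ℤ} → (∀ i → f i ≡ g (toℕ i)) → sumFinℤ f ≡ Σℤ n g
  sumFinℤ≡Σℤ zero e = refl
  sumFinℤ≡Σℤ (suc n) e = cong₂ _+_ (e Fin.zero) (sumFinℤ≡Σℤ n (λ i → e (Fin.suc i)))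

  sumFin²≡Σℕ² : ∀ n (P : Fin n → Fin n → Bool) (H : Bool → ℕ → ℕ → ℕ) →
    sumFin (λ x → sumFin (λ y → H (P x y) (toℕ x) (toℕ y))) ≡ Σℕ n (λ x → Σℕ n (λ y → H (extend² false P x y) x y))
  sumFin²≡Σℕ² n P H = sumFin≡Σℕ n (λ x → sumFin≡Σℕ n (λ y → cong (λ b → H b (toℕ x) (toℕ y)) (sym (extend²-toℕ false P x y))))

  sumFinℤ²≡Σℤ² : ∀ n (P : Fin n → Fin n → Bool) (χ : Fin n → Fin n → Sign) (H : Bool → Sign → ℕ → ℕ → ℤ) →
    sumFinℤ (λ x → sumFinℤ (λ y → H (P x y) (χ x y) (toℕ x) (toℕ y))) ≡
    Σℤ n (λ x → Σℤ n (λ y → H (extend² false P x y) (extend² Sign.+ χ x y) x y))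
  sumFinℤ²≡Σℤ² n P χ H = sumFinℤ≡Σℤ n (λ x → sumFinℤ≡Σℤ n (λ y →
    cong₂ (λ b σ → H b σ (toℕ x) (toℕ y)) (sym (extend²-toℕ false P x y)) (sym (extend²-toℕ Sign.+ χ x y))))

  signedWeight : Bool → Sign → ℤ
  signedWeight b σ = if b then σ ◃ 1 else + 0

  ∣signedWeight∣ : ∀ b σ → ∣ signedWeight b σ ∣ ≡ (if b then 1 else 0)
  ∣signedWeight∣ false σ = refl
  ∣signedWeight∣ true σ = ℤP.abs-◃ σ 1

  -- The cases c = 0 and c = 1 of: z and v are a signed and an unsigned sum of the same values over c points.
  ±Sum : ℕ → ℤ → ℕ → Set
  ±Sum c z v = (c ≡ 0 → (z ≡ + 0) × (v ≡ 0)) × (c ≡ 1 → (z ≡ + v) ⊎ (z ≡ - + v))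

  ±Sum-+ : ∀ {c₁ z₁ v₁ c₂ z₂ v₂} → ±Sum c₁ z₁ v₁ → ±Sum c₂ z₂ v₂ → ±Sum (c₁ ℕ.+ c₂) (z₁ + z₂) (v₁ ℕ.+ v₂)
  ±Sum-+ {zero} {z₁} {v₁} {c₂} {z₂} {v₂} g₁ g₂ with proj₁ g₁ refl
  ... | refl , refl = subst (λ z → ±Sum c₂ z v₂) (sym (ℤP.+-identityˡ z₂)) g₂
  ±Sum-+ {suc c₁} {z₁} {v₁} {zero} {z₂} {v₂} g₁ g₂ with proj₁ g₂ refl
  ... | refl , refl rewrite ℕP.+-identityʳ c₁ | ℤP.+-identityʳ z₁ | ℕP.+-identityʳ v₁ = g₁
  ±Sum-+ {suc c₁} {c₂ = suc c₂} g₁ g₂ = (λ ()) , λ c≡1 → ⊥-elim (ℕP.1+n≢0 (trans (sym (ℕP.+-suc c₁ c₂)) (ℕP.suc-injective c≡1)))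

  ±Sum-Σ : ∀ n (c : ℕ → ℕ) (z : ℕ → ℤ) (v : ℕ → ℕ) → (∀ t → ±Sum (c t) (z t) (v t)) → ±Sum (Σℕ n c) (Σℤ n z) (Σℕ n v)
  ±Sum-Σ zero c z v g = (λ _ → refl , refl) , λ ()
  ±Sum-Σ (suc n) c z v g = ±Sum-+ (g 0) (±Sum-Σ n _ _ _ (λ t → g (suc t)))

  ±Sum-point : ∀ b c σ v →
    ±Sum (if b ∧ c then 1 else 0) (signedWeight b σ * (if c then + v else + 0)) (if b ∧ c then v else 0)
  ±Sum-point false c σ v = (λ _ → refl , refl) , λ ()
  ±Sum-point true false σ v = (λ _ → ℤP.*-zeroʳ (σ ◃ 1) , refl) , λ ()
  ±Sum-point true true Sign.+ v = (λ ()) , λ _ → inj₁ (ℤP.*-identityˡ (+ v))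
  ±Sum-point true true Sign.- v = (λ ()) , λ _ → inj₂ (ℤP.-1*i≡-i (+ v))

  ∣⊖∣ : ∀ a b → ∣ a ℤ.⊖ b ∣ ≡ ℕ.∣ a - b ∣
  ∣⊖∣ a b with ℕP.≤-total b a
  ... | inj₁ b≤a = trans (cong ∣_∣ (ℤP.⊖-≥ b≤a)) (sym (ℕP.m≤n⇒∣n-m∣≡n∸m b≤a))
  ... | inj₂ a≤b = trans (cong ∣_∣ (ℤP.⊖-≤ a≤b)) (trans (ℤP.∣-i∣≡∣i∣ (+ (b ∸ a))) (sym (ℕP.m≤n⇒∣m-n∣≡n∸m a≤b)))

  ∣-∣≤∣±+±∣ : ∀ z₁ z₂ v₁ v₂ → (z₁ ≡ + v₁) ⊎ (z₁ ≡ - + v₁) → (z₂ ≡ + v₂) ⊎ (z₂ ≡ - + v₂) → ℕ.∣ v₁ - v₂ ∣ ≤ ∣ z₁ + z₂ ∣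
  ∣-∣≤∣±+±∣ _ _ v₁ v₂ (inj₁ refl) (inj₁ refl) rewrite sym (ℤP.pos-+ v₁ v₂) =
    ℕP.≤-trans (ℕP.∣m-n∣≤m⊔n v₁ v₂) (ℕP.m⊔n≤m+n v₁ v₂)
  ∣-∣≤∣±+±∣ _ _ v₁ v₂ (inj₁ refl) (inj₂ refl) rewrite ℤP.m-n≡m⊖n v₁ v₂ = ℕP.≤-reflexive (sym (∣⊖∣ v₁ v₂))
  ∣-∣≤∣±+±∣ _ _ v₁ v₂ (inj₂ refl) (inj₁ refl) rewrite ℤP.+-comm (- + v₁) (+ v₂) | ℤP.m-n≡m⊖n v₂ v₁ =
    ℕP.≤-reflexive (trans (ℕP.∣-∣-comm v₁ v₂) (sym (∣⊖∣ v₂ v₁)))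
  ∣-∣≤∣±+±∣ _ _ v₁ v₂ (inj₂ refl) (inj₂ refl)
    rewrite sym (ℤP.neg-distrib-+ (+ v₁) (+ v₂)) | ℤP.∣-i∣≡∣i∣ (+ v₁ + + v₂) | sym (ℤP.pos-+ v₁ v₂) =
    ℕP.≤-trans (ℕP.∣m-n∣≤m⊔n v₁ v₂) (ℕP.m⊔n≤m+n v₁ v₂)

  anchoredBox : ℕ → ℕ → Rectangle
  anchoredBox u v = rect 0ℚ ((+ u) ℚ./ 2) 0ℚ ((+ v) ℚ./ 2)

  inRect-anchoredBox : ∀ u v x y → inRect (anchoredBox u v) x y ≡ ((2 ℕ.* x ℕ.+ 1) ≤ᵇ u) ∧ ((2 ℕ.* y ℕ.+ 1) ≤ᵇ v)
  inRect-anchoredBox u v x y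
    rewrite 0≤ᵇhalf (2 ℕ.* x ℕ.+ 1) | 0≤ᵇhalf (2 ℕ.* y ℕ.+ 1)
          | half≤ᵇhalf (2 ℕ.* x ℕ.+ 1) u | half≤ᵇhalf (2 ℕ.* y ℕ.+ 1) v = refl

  module TwoNets (m : ℕ) (P₁ P₂ : PointSet m) (χ₁ χ₂ : Colouring m) where

    weightOf : PointSet m → Colouring m → ℕ → ℕ → ℤ
    weightOf P χ x y = signedWeight (extend² false P x y) (extend² Sign.+ χ x y)

    weight : ℕ → ℕ → ℤ
    weight x y = weightOf P₁ χ₁ x y + weightOf P₂ χ₂ x y

    open WeightedGrid m weight

    member : PointSet m → ℕ → ℕ → ℕ
    member P x y = if extend² false P x y then 1 else 0

    cellCount≡ : ∀ P k i j → cellCount m P k i j ≡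
      Σℕ n (λ x → Σℕ n (λ y → if extend² false P x y ∧ inCell m k i j x y then 1 else 0))
    cellCount≡ P k i j = sumFin²≡Σℕ² n P (λ b x y → if b ∧ inCell m k i j x y then 1 else 0)

    V4≡ : ∀ P k i j → V4 m P k i j ≡
      Σℕ n (λ x → Σℕ n (λ y → if extend² false P x y ∧ inCell m k i j x y then cornerVol4 m k i j x y else 0))
    V4≡ P k i j = sumFin²≡Σℕ² n P (λ b x y → if b ∧ inCell m k i j x y then cornerVol4 m k i j x y else 0)

    size : ∀ P → IsBinaryNet m P → Σℕ n (λ x → Σℕ n (λ y → member P x y)) ≡ n
    size P net = ℤP.+-injective (begin
        + Σℕ n (λ x → Σℕ n (λ y → member P x y))
          ≡⟨ sym (trans (Σℤ-cong n (λ x _ → Σℤ-pos n (member P x))) (Σℤ-pos n _)) ⟩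
        Σℤ n (λ x → Σℤ n (λ y → + member P x y))
          ≡⟨ Σ-by-cells m 0 z≤n (λ _ _ x y → + member P x y) ⟩
        Σℤ n (λ i → Σℤ 1 (λ j → Σℤ n (λ x → Σℤ n (λ y → if inCell m 0 i j x y then + member P x y else + 0))))
          ≡⟨ Σℤ-cong n (λ i i< → Σℤ-cong 1 (λ j j< → column i j i< j<)) ⟩
        Σℤ n (λ i → Σℤ 1 (λ j → + 1))
          ≡⟨ trans (Σℤ-pos n (λ _ → 1)) (cong +_ (trans (Σℕ-const n 1) (ℕP.*-identityʳ n))) ⟩
        + n ∎)
      where
      open ≡-Reasoning
      restrict : ∀ b c → (if c then + (if b then 1 else 0) else + 0) ≡ + (if b ∧ c then 1 else 0)
      restrict false false = refl
      restrict false true = refl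
      restrict true false = refl
      restrict true true = refl
      column : ∀ i j → i < n → j < 1 →
        Σℤ n (λ x → Σℤ n (λ y → if inCell m 0 i j x y then + member P x y else + 0)) ≡ + 1
      column i j i< j< = begin
          Σℤ n (λ x → Σℤ n (λ y → if inCell m 0 i j x y then + member P x y else + 0))
            ≡⟨ Σℤ-cong n (λ x _ → Σℤ-cong n (λ y _ → restrict (extend² false P x y) (inCell m 0 i j x y))) ⟩
          Σℤ n (λ x → Σℤ n (λ y → + (if extend² false P x y ∧ inCell m 0 i j x y then 1 else 0)))
            ≡⟨ trans (Σℤ-cong n (λ x _ → Σℤ-pos n _)) (Σℤ-pos n _) ⟩
          + Σℕ n (λ x → Σℕ n (λ y → if extend² false P x y ∧ inCell m 0 i j x y then 1 else 0))
            ≡⟨ cong +_ (trans (sym (cellCount≡ P 0 i j)) (net 0 z≤n i i< j j<)) ⟩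
          + 1 ∎

    mass≤2n : IsBinaryNet m P₁ → IsBinaryNet m P₂ → mass ≤ 2 ℕ.* n
    mass≤2n net₁ net₂ = begin
        Σℕ n (λ x → Σℕ n (λ y → ∣ weight x y ∣))
          ≤⟨ Σℕ-mono n _ _ (λ x _ → Σℕ-mono n _ _ (λ y _ → pointwise x y)) ⟩
        Σℕ n (λ x → Σℕ n (λ y → member P₁ x y ℕ.+ member P₂ x y))
          ≡⟨ trans (Σℕ-cong n (λ x _ → Σℕ-+ n _ _)) (Σℕ-+ n _ _) ⟩
        Σℕ n (λ x → Σℕ n (λ y → member P₁ x y)) ℕ.+ Σℕ n (λ x → Σℕ n (λ y → member P₂ x y))
          ≡⟨ cong₂ ℕ._+_ (size P₁ net₁) (trans (size P₂ net₂) (sym (ℕP.+-identityʳ n))) ⟩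
        2 ℕ.* n ∎
      where
      open ℕP.≤-Reasoning
      pointwise : ∀ x y → ∣ weight x y ∣ ≤ member P₁ x y ℕ.+ member P₂ x y
      pointwise x y = ℕP.≤-trans (ℤP.∣i+j∣≤∣i∣+∣j∣ (weightOf P₁ χ₁ x y) _)
        (ℕP.≤-reflexive (cong₂ ℕ._+_ (∣signedWeight∣ (extend² false P₁ x y) _) (∣signedWeight∣ (extend² false P₂ x y) _)))

    partialCorr : PointSet m → Colouring m → ℕ → ℕ → ℕ → ℤ
    partialCorr P χ K i j =
      Σℤ n (λ x → Σℤ n (λ y → weightOf P χ x y * (if inCell m K i j x y then + cornerVol4 m K i j x y else + 0)))

    corr≡ : ∀ K i j → corr K i j ≡ partialCorr P₁ χ₁ K i j + partialCorr P₂ χ₂ K i j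
    corr≡ K i j = trans (Σℤ-cong n (λ x _ → Σℤ-cong n (λ y _ → ℤP.*-distribʳ-+ _ (weightOf P₁ χ₁ x y) _)))
                        (trans (Σℤ-cong n (λ x _ → Σℤ-+ n _ _)) (Σℤ-+ n _ _))

    partialCorr-±Sum : ∀ P χ K i j → ±Sum (cellCount m P K i j) (partialCorr P χ K i j) (V4 m P K i j)
    partialCorr-±Sum P χ K i j rewrite cellCount≡ P K i j | V4≡ P K i j =
      ±Sum-Σ n _ _ _ (λ x → ±Sum-Σ n _ _ _ (λ y →
        ±Sum-point (extend² false P x y) (inCell m K i j x y) (extend² Sign.+ χ x y) (cornerVol4 m K i j x y)))

    ∣V4-V4∣≤∣corr∣ : IsBinaryNet m P₁ → IsBinaryNet m P₂ → ∀ k → k ≤ m → ∀ i → i < 2 ^ (m ∸ k) → ∀ j → j < 2 ^ k →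
      ℕ.∣ V4 m P₁ k i j - V4 m P₂ k i j ∣ ≤ ∣ corr k i j ∣
    ∣V4-V4∣≤∣corr∣ net₁ net₂ k k≤m i i< j j< rewrite corr≡ k i j =
      ∣-∣≤∣±+±∣ _ _ _ _ (proj₂ (partialCorr-±Sum P₁ χ₁ k i j) (net₁ k k≤m i i< j j<))
                        (proj₂ (partialCorr-±Sum P₂ χ₂ k i j) (net₂ k k≤m i i< j j<))

    Δ4≤cellMass : IsBinaryNet m P₁ → IsBinaryNet m P₂ → Δ4 m P₁ P₂ ≤ sumNat (suc m) cellMass
    Δ4≤cellMass net₁ net₂ = sumNat-mono (suc m) _ _ (λ k k< →
      sumNat-mono-Σℕ (2 ^ (m ∸ k)) _ _ (λ i i< → sumNat-mono-Σℕ (2 ^ k) _ _ (λ j j< →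
        ∣V4-V4∣≤∣corr∣ net₁ net₂ k (ℕP.≤-pred k<) i i< j j<)))

    signedSum-anchoredBox : ∀ P χ u v → signedSum m P χ (anchoredBox u v) ≡
      Σℤ n (λ x → Σℤ n (λ y → weightOf P χ x y * (𝟙[ 2 ℕ.* x ℕ.+ 1 ≤ u ] * 𝟙[ 2 ℕ.* y ℕ.+ 1 ≤ v ])))
    signedSum-anchoredBox P χ u v =
      trans (sumFinℤ²≡Σℤ² n P χ (λ b σ x y → if b ∧ inRect (anchoredBox u v) x y then σ ◃ 1 else + 0))
            (Σℤ-cong n (λ x _ → Σℤ-cong n (λ y _ → pointwise (extend² false P x y) (extend² Sign.+ χ x y) x y)))
      where
      pointwise : ∀ b σ x y → (if b ∧ inRect (anchoredBox u v) x y then σ ◃ 1 else + 0) ≡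
        signedWeight b σ * (𝟙[ 2 ℕ.* x ℕ.+ 1 ≤ u ] * 𝟙[ 2 ℕ.* y ℕ.+ 1 ≤ v ])
      pointwise b σ x y rewrite inRect-anchoredBox u v x y | 𝟙-≤ᵇ (2 ℕ.* x ℕ.+ 1) u | 𝟙-≤ᵇ (2 ℕ.* y ℕ.+ 1) v
        with b | 2 ℕ.* x ℕ.+ 1 ≤ᵇ u | 2 ℕ.* y ℕ.+ 1 ≤ᵇ v
      ... | false | _ | _ = refl
      ... | true | false | _ = sym (ℤP.*-zeroʳ (σ ◃ 1))
      ... | true | true | false = sym (ℤP.*-zeroʳ (σ ◃ 1))
      ... | true | true | true = sym (ℤP.*-identityʳ (σ ◃ 1))

    anchoredDisc≡ : ∀ u v → anchoredDisc u v ≡ signedSum m P₁ χ₁ (anchoredBox u v) + signedSum m P₂ χ₂ (anchoredBox u v)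
    anchoredDisc≡ u v = sym (trans (cong₂ _+_ (signedSum-anchoredBox P₁ χ₁ u v) (signedSum-anchoredBox P₂ χ₂ u v))
      (trans (sym (trans (Σℤ-cong n (λ x _ → Σℤ-+ n _ _)) (Σℤ-+ n _ _)))
        (Σℤ-cong n (λ x _ → Σℤ-cong n (λ y _ → sym (ℤP.*-distribʳ-+ _ (weightOf P₁ χ₁ x y) (weightOf P₂ χ₂ x y)))))))

    anchored-discrepancy-bound : ∀ q → 1 ≤ m → IsBinaryNet m P₁ → IsBinaryNet m P₂ →
      n ℕ.* n ℕ.* m ℕ.* 4 ≤ q ℕ.* Δ4 m P₁ P₂ →
      ∃₂ λ u v → m ≤ suc (4 ℕ.* q ℕ.* suc (4 ℕ.* q)) ℕ.* ∣ signedSum m P₁ χ₁ (anchoredBox u v) + signedSum m P₂ χ₂ (anchoredBox u v) ∣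
    anchored-discrepancy-bound q m≥1 net₁ net₂ separated =
      u* , v* , subst (λ z → m ≤ suc K ℕ.* ∣ z ∣) (anchoredDisc≡ u* v*)
        (m≤[1+K]B q m n B (Δ4 m P₁ P₂) (sumNat (suc m) cellMass) mass m≥1 (ℕP.*-mono-≤ (ℕP.m^n>0 2 m) (ℕP.m^n>0 2 m))
          separated (Δ4≤cellMass net₁ net₂) (cellMass-bound B maximal) (mass≤2n net₁ net₂))
      where
      open Riesz₂ m (4 ℕ.* q) weight using (cellMass-bound)
      K = 4 ℕ.* q ℕ.* suc (4 ℕ.* q)
      best = argmax² N (λ u v → ∣ anchoredDisc u v ∣)
      u* = proj₁ best
      v* = proj₁ (proj₂ best)
      B = ∣ anchoredDisc u* v* ∣
      maximal = proj₂ (proj₂ best)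

  discUnionAtLeast : ∀ c d → (∀ A D → c ℚ.* ℕtoℚ A ℚ.≤ (+ D) ℚ./ 4 → A ℕ.* 4 ≤ suc d ℕ.* D) →
    ∀ m → 1 ≤ m → ∀ P₁ P₂ → IsBinaryNet m P₁ → IsBinaryNet m P₂ →
    c ℚ.* ℕtoℚ (2 ^ m ℕ.* 2 ^ m ℕ.* m) ℚ.≤ cornerVolumeDistance m P₁ P₂ →
    DiscUnionAtLeast m P₁ P₂ (((+ 1) ℚ./ suc (4 ℕ.* suc d ℕ.* suc (4 ℕ.* suc d))) ℚ.* ℕtoℚ m)
  discUnionAtLeast c d scale m m≥1 P₁ P₂ net₁ net₂ separated χ₁ χ₂ =
    anchoredBox u v , ≤-1/suc (4 ℕ.* suc d ℕ.* suc (4 ℕ.* suc d)) m ∣disc∣ (proj₂ (proj₂ box))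
    where
    box = TwoNets.anchored-discrepancy-bound m P₁ P₂ χ₁ χ₂ (suc d) m≥1 net₁ net₂
            (scale (2 ^ m ℕ.* 2 ^ m ℕ.* m) (Δ4 m P₁ P₂) separated)
    u = proj₁ box
    v = proj₁ (proj₂ box)
    ∣disc∣ = ∣ signedSum m P₁ χ₁ (anchoredBox u v) + signedSum m P₂ χ₂ (anchoredBox u v) ∣

open import Defs
open import Data.Nat using (ℕ; _*_; _^_; _≤_)
open import Data.Rational using (ℚ; 0ℚ; _<_) renaming (_≤_ to _≤ℚ_; _*_ to _*ℚ_)
open import Data.Product using (∃; _×_)

open import Data.Nat using (suc)
open import Data.Integer using (+_)
open import Data.Product using (_,_; proj₁; proj₂)
import Data.Rational as ℚ
open RieszProducts

lemma5 : ∀ (c : ℚ) → 0ℚ < c →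
    ∃ λ (c′ : ℚ) → 0ℚ < c′ ×
      (∀ (m : ℕ) → 1 ≤ m → ∀ (P₁ P₂ : PointSet m) →
        IsBinaryNet m P₁ → IsBinaryNet m P₂ →
        c *ℚ ℕtoℚ (2 ^ m * 2 ^ m * m) ≤ℚ cornerVolumeDistance m P₁ P₂ →
        DiscUnionAtLeast m P₁ P₂ (c′ *ℚ ℕtoℚ m))
lemma5 c 0<c = (+ 1) ℚ./ suc K , 0<1/suc K , discUnionAtLeast c d (proj₂ ≥1/q)
  where
  ≥1/q = positive⇒≥1/q c 0<c
  d = proj₁ ≥1/q
  K = 4 * suc d * suc (4 * suc d)
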